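{- Let $G$ be a finite simple graph that is edge-maximal $K_4$-minor-free, i.e. $G$ has no $K_4$-minor but adding any edge joining two non-adjacent vertices of $G$ creates a $K_4$-minor. Then $G$ is 2-clique-colorable.
   Context: A $k$-clique-coloring of a graph $G$ is a map $\phi: V(G)\to\{1,\dots,k\}$ such that no maximal clique of $G$ with at least two vertices is monochromatic (a clique is a complete induced subgraph; it is maximal if not properly contained in another clique). $G$ is $k$-clique-colorable if it admits a $k$-clique-coloring. A graph $H$ is a minor of $G$ if $H$ can be obtained from $G$ by deleting edges, deleting vertices and contracting edges. -}

module Defs where

open import Data.Nat using (ℕ; zero; suc; _≤_)
open import Data.Bool using (Bool; true; false; _∧_; _∨_; not)
open import Data.Bool.Properties using (∨-comm)
open import Data.Fin using (Fin; punchIn)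
open import Data.Fin.Properties using (_≟_)
open import Data.Fin.Subset using (Subset; _∈_; _⊆_; ∣_∣)
open import Data.Product using (Σ; ∃; _×_; _,_)
open import Function.Bundles using (_↔_; Inverse)
open import Relation.Nullary using (¬_; yes; no)
open import Relation.Nullary.Decidable using (⌊_⌋)
open import Relation.Binary.PropositionalEquality using (_≡_; _≢_; refl; cong₂)

record Graph (n : ℕ) : Set where
  field
    adj    : Fin n → Fin n → Bool
    sym    : ∀ u v → adj u v ≡ adj v u
    irrefl : ∀ v → adj v v ≡ false
open Graph public

Edge : ∀ {n} → Graph n → Fin n → Fin n → Set
Edge G u v = adj G u v ≡ true

_==_ : ∀ {n} → Fin n → Fin n → Bool
x == y = ⌊ x ≟ y ⌋

private
  ==-sym : ∀ {n} (x y : Fin n) → (x == y) ≡ (y == x)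
  ==-sym x y with x ≟ y | y ≟ x
  ... | yes _  | yes _  = refl
  ... | no _   | no _   = refl
  ... | yes p  | no ¬q  with ¬q (Relation.Binary.PropositionalEquality.sym p)
  ... | ()
  ==-sym x y | no ¬p | yes q with ¬p (Relation.Binary.PropositionalEquality.sym q)
  ... | ()

  ==-refl : ∀ {n} (x : Fin n) → (x == x) ≡ true
  ==-refl x with x ≟ x
  ... | yes _ = refl
  ... | no ¬p with ¬p refl
  ... | ()

mkSimple : ∀ {n} → (Fin n → Fin n → Bool) → Graph n
mkSimple r = record
  { adj    = λ x y → not (x == y) ∧ (r x y ∨ r y x)
  ; sym    = λ x y → cong₂ (λ a b → not a ∧ b) (==-sym x y) (∨-comm (r x y) (r y x))
  ; irrefl = λ x → cong₂ (λ a b → not a ∧ b) (==-refl x) refl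
  }

K4 : Graph 4
K4 = mkSimple (λ _ _ → true)

addEdge : ∀ {n} → Graph n → Fin n → Fin n → Graph n
addEdge G u v = mkSimple (λ x y → adj G x y ∨ ((x == u) ∧ (y == v)))

deleteEdge : ∀ {n} → Graph n → Fin n → Fin n → Graph n
deleteEdge G u v =
  mkSimple (λ x y → adj G x y ∧ not (((x == u) ∧ (y == v)) ∨ ((x == v) ∧ (y == u))))

deleteVertex : ∀ {n} → Graph (suc n) → Fin (suc n) → Graph n
deleteVertex G v = mkSimple (λ x y → adj G (punchIn v x) (punchIn v y))

-- G / uv : contract the edge uv (u ≠ v): vertex v is merged into u, i.e. v is
-- removed and u becomes adjacent to every neighbour of v (other than u itself).
contractEdge : ∀ {n} → Graph (suc n) → Fin (suc n) → Fin (suc n) → Graph n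
contractEdge G u v = mkSimple λ x y →
  let x' = punchIn v x ; y' = punchIn v y in
  adj G x' y' ∨ ((x' == u) ∧ adj G v y')

_≅_ : ∀ {m n} → Graph m → Graph n → Set
_≅_ {m} {n} H G =
  Σ (Fin m ↔ Fin n) λ f → ∀ x y → adj G (Inverse.to f x) (Inverse.to f y) ≡ adj H x y

infix 4 _≼_
data _≼_ {m : ℕ} (H : Graph m) : {n : ℕ} → Graph n → Set where
  done       : ∀ {n} {G : Graph n} → H ≅ G → H ≼ G
  delEdge    : ∀ {n} {G : Graph n} (u v : Fin n) → Edge G u v →
               H ≼ deleteEdge G u v → H ≼ G
  delVertex  : ∀ {n} {G : Graph (suc n)} (v : Fin (suc n)) →
               H ≼ deleteVertex G v → H ≼ G
  contract   : ∀ {n} {G : Graph (suc n)} (u v : Fin (suc n)) → Edge G u v →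
               H ≼ contractEdge G u v → H ≼ G

EdgeMaximalK4MinorFree : ∀ {n} → Graph n → Set
EdgeMaximalK4MinorFree G =
  ¬ (K4 ≼ G) × (∀ u v → u ≢ v → ¬ Edge G u v → K4 ≼ addEdge G u v)

IsClique : ∀ {n} → Graph n → Subset n → Set
IsClique G S = ∀ {u v} → u ∈ S → v ∈ S → u ≢ v → Edge G u v

IsMaximalClique : ∀ {n} → Graph n → Subset n → Set
IsMaximalClique G S = IsClique G S × (∀ T → IsClique G T → S ⊆ T → T ⊆ S)

Monochromatic : ∀ {n k} → (Fin n → Fin k) → Subset n → Set
Monochromatic φ S = ∀ {u v} → u ∈ S → v ∈ S → φ u ≡ φ v

IsCliqueColoring : ∀ {n} → Graph n → (k : ℕ) → (Fin n → Fin k) → Set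
IsCliqueColoring G k φ =
  ∀ S → IsMaximalClique G S → 2 ≤ ∣ S ∣ → ¬ Monochromatic φ S

CliqueColorable : ∀ {n} → Graph n → ℕ → Set
CliqueColorable {n} G k = Σ (Fin n → Fin k) (IsCliqueColoring G k)

module Submission where

-- Minors are handled through K₄-models (four connected, pairwise adjacent
-- branch sets): model⇒minor and minor⇒model show that G has a K₄ minor iff
-- Edge G has a model, so the rest works with edge relations on Fin n.
-- Suppressing a vertex v with N(v) ⊆ {a,b} (delete v, join a and b) preserves
-- models (suppress-model), and is reversible when v is adjacent to a and b
-- (unsuppress-model).  Dirac's theorem, in a relative form proved with a
-- maximal-path argument, gives a model once every vertex has three distinct
-- neighbours.  The colouring is built by induction on a set A of active
-- vertices (colour): if R is model-free and edge-maximal on A, Dirac yields an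
-- active v of degree ≤ 2, maximality and suppression force N(v) = {a,b} with
-- ab an edge, v is deactivated, and v is finally coloured opposite to a.

open import Data.Nat using (ℕ; zero; suc; _+_; _≤_; _<_; z≤n; s≤s; pred) renaming (_≤?_ to _≤?ℕ_)
open import Data.Nat.Properties
  using (≤-refl; ≤-trans; <-trans; <-irrefl; <-asym; n<1+n; n≤1+n; m≤n⇒m≤1+n; <⇒≤;
         ≤-<-trans; <-≤-trans; ≤∧≢⇒<; <⇒≢; ≤-pred; +-suc; +-comm; +-identityʳ; m≤m+n;
         +-mono-≤; +-monoˡ-≤; +-monoʳ-<; <-cmp; ≰⇒>; anyUpTo?)
  renaming (_≟_ to _≟ℕ_; _<?_ to _<ℕ?_)
open import Data.Bool using (Bool; true; false; _∧_; _∨_; not)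
open import Data.Bool.Properties using () renaming (_≟_ to _≟B_)
open import Data.Fin using (Fin; zero; suc; toℕ; punchIn; punchOut)
open import Data.Fin.Properties
  using (_≟_; any?; pigeonhole; toℕ<n; suc-injective; punchInᵢ≢i; punchIn-punchOut;
         punchOut-punchIn; punchIn-injective; punchOut-cong)
open import Data.Fin.Subset using (Subset; _∈_; _⊆_; ∣_∣; _∪_; ⁅_⁆; inside; outside)
open import Data.Fin.Subset.Properties using (p⊆p∪q; q⊆p∪q; x∈p∪q⁻; x∈⁅x⁆; x∈⁅y⁆⇒x≡y; _∈?_)
open import Data.Vec.Base using (here; there; _∷_)
open import Data.Maybe using (Maybe; just; nothing)
open import Data.Maybe.Properties using (just-injective) renaming (≡-dec to ≡-decMaybe)
open import Data.Product using (Σ; _×_; _,_; proj₁; proj₂)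
open import Data.Sum using (_⊎_; inj₁; inj₂)
open import Data.Empty using (⊥; ⊥-elim)
open import Function.Bundles using (Inverse; mk↔ₛ′)
open import Relation.Nullary using (¬_; yes; no; Dec)
open import Relation.Nullary.Decidable using (_×-dec_; _⊎-dec_; ¬?; decidable-stable)
open import Relation.Binary.Definitions using (tri<; tri≈; tri>)
open import Relation.Binary.PropositionalEquality
  using (_≡_; _≢_; refl; sym; trans; cong; subst; subst₂)
open import Defs hiding (sym)

∧-true : ∀ {a b} → a ∧ b ≡ true → a ≡ true × b ≡ true
∧-true {true} {true} _ = refl , refl

∨-true : ∀ {a b} → a ∨ b ≡ true → a ≡ true ⊎ b ≡ true
∨-true {true} _ = inj₁ refl
∨-true {false} p = inj₂ p

∨-introˡ : ∀ {a b} → a ≡ true → a ∨ b ≡ true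
∨-introˡ refl = refl

∨-introʳ : ∀ {a b} → b ≡ true → a ∨ b ≡ true
∨-introʳ {true} _ = refl
∨-introʳ {false} p = p

not-true : ∀ {a} → not a ≡ true → a ≡ false
not-true {false} _ = refl

true≢false : ∀ {b} → b ≡ true → b ≡ false → ⊥
true≢false refl ()

==⇒≡ : ∀ {n} {x y : Fin n} → (x == y) ≡ true → x ≡ y
==⇒≡ {x = x} {y} p with x ≟ y
... | yes q = q
==⇒≡ () | no _

==-false⇒≢ : ∀ {n} {x y : Fin n} → (x == y) ≡ false → x ≢ y
==-false⇒≢ {x = x} {y} p with x ≟ y
==-false⇒≢ () | yes _
... | no x≢y = x≢y

≢⇒==-false : ∀ {n} {x y : Fin n} → x ≢ y → (x == y) ≡ false
≢⇒==-false {x = x} {y} x≢y with x ≟ y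
... | yes x≡y = ⊥-elim (x≢y x≡y)
... | no _ = refl

==-refl : ∀ {n} (x : Fin n) → (x == x) ≡ true
==-refl x with x ≟ x
... | yes _ = refl
... | no x≢x = ⊥-elim (x≢x refl)

just≢nothing : ∀ {A : Set} {a : A} → just a ≢ nothing
just≢nothing ()

punchOut′ : ∀ {n} {x z : Fin (suc n)} → z ≢ x → Fin n
punchOut′ {x = x} z≢x = punchOut {i = x} (λ eq → z≢x (sym eq))

punchIn-punchOut′ : ∀ {n} {x z : Fin (suc n)} (z≢x : z ≢ x) → punchIn x (punchOut′ z≢x) ≡ z
punchIn-punchOut′ _ = punchIn-punchOut _

punchIn-cases : ∀ {n} (v x : Fin (suc n)) → x ≡ v ⊎ Σ (Fin n) λ y → x ≡ punchIn v y
punchIn-cases v x with x ≟ v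
... | yes x≡v = inj₁ x≡v
... | no x≢v = inj₂ (punchOut′ x≢v , sym (punchIn-punchOut′ x≢v))

-- Edges of the graphs built by the operations of Defs; the underlying Boolean
-- relations are named so that mkSimple-edge⁻/⁺ can be instantiated with them.

deleteVertexRel : ∀ {n} → Graph (suc n) → Fin (suc n) → Fin n → Fin n → Bool
deleteVertexRel G v x y = adj G (punchIn v x) (punchIn v y)

deleteEdgeRel : ∀ {n} → Graph n → Fin n → Fin n → Fin n → Fin n → Bool
deleteEdgeRel G u v x y = adj G x y ∧ not (((x == u) ∧ (y == v)) ∨ ((x == v) ∧ (y == u)))

contractRel : ∀ {n} → Graph (suc n) → Fin (suc n) → Fin (suc n) → Fin n → Fin n → Bool
contractRel G u v x y = adj G (punchIn v x) (punchIn v y) ∨ ((punchIn v x == u) ∧ adj G v (punchIn v y))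

addRel : ∀ {n} → Graph n → Fin n → Fin n → Fin n → Fin n → Bool
addRel G u w x y = adj G x y ∨ ((x == u) ∧ (y == w))

Edge-sym : ∀ {n} (G : Graph n) {x y} → Edge G x y → Edge G y x
Edge-sym G {x} {y} e = trans (sym (Graph.sym G x y)) e

Edge-irrefl : ∀ {n} (G : Graph n) {x y} → Edge G x y → x ≢ y
Edge-irrefl G {x} e refl = true≢false e (irrefl G x)

mkSimple-edge⁻ : ∀ {n} (r : Fin n → Fin n → Bool) {x y} → Edge (mkSimple r) x y →
                 x ≢ y × (r x y ≡ true ⊎ r y x ≡ true)
mkSimple-edge⁻ r {x} {y} e with ∧-true {not (x == y)} e
... | x≠y , rxy = ==-false⇒≢ (not-true x≠y) , ∨-true rxy

mkSimple-edge⁺ : ∀ {n} (r : Fin n → Fin n → Bool) {x y} → x ≢ y →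
                 r x y ≡ true ⊎ r y x ≡ true → Edge (mkSimple r) x y
mkSimple-edge⁺ r {x} {y} x≢y rxy rewrite ≢⇒==-false x≢y with rxy
... | inj₁ p = ∨-introˡ p
... | inj₂ p = ∨-introʳ p

K4-edge : ∀ {a b : Fin 4} → a ≢ b → Edge K4 a b
K4-edge a≢b = mkSimple-edge⁺ _ a≢b (inj₁ refl)

deleteVertex-edge⁻ : ∀ {n} (G : Graph (suc n)) v {x y} → Edge (deleteVertex G v) x y →
                     Edge G (punchIn v x) (punchIn v y)
deleteVertex-edge⁻ G v e with mkSimple-edge⁻ (deleteVertexRel G v) e
... | _ , inj₁ p = p
... | _ , inj₂ p = Edge-sym G p

deleteVertex-edge⁺ : ∀ {n} (G : Graph (suc n)) v {x y} → Edge G (punchIn v x) (punchIn v y) →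
                     Edge (deleteVertex G v) x y
deleteVertex-edge⁺ G v e =
  mkSimple-edge⁺ (deleteVertexRel G v) (λ eq → Edge-irrefl G e (cong (punchIn v) eq)) (inj₁ e)

deleteEdge-edge⁻ : ∀ {n} (G : Graph n) u v {x y} → Edge (deleteEdge G u v) x y → Edge G x y
deleteEdge-edge⁻ G u v e with mkSimple-edge⁻ (deleteEdgeRel G u v) e
... | _ , inj₁ p = proj₁ (∧-true p)
... | _ , inj₂ p = Edge-sym G (proj₁ (∧-true p))

contractEdge-edge⁻ : ∀ {n} (G : Graph (suc n)) u v {x y} → Edge (contractEdge G u v) x y →
  x ≢ y × (Edge G (punchIn v x) (punchIn v y)
           ⊎ (punchIn v x ≡ u × Edge G v (punchIn v y))
           ⊎ (punchIn v y ≡ u × Edge G v (punchIn v x)))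
contractEdge-edge⁻ G u v e with mkSimple-edge⁻ (contractRel G u v) e
... | x≢y , inj₁ p with ∨-true p
...   | inj₁ old = x≢y , inj₁ old
...   | inj₂ new = x≢y , inj₂ (inj₁ (==⇒≡ (proj₁ (∧-true new)) , proj₂ (∧-true new)))
contractEdge-edge⁻ G u v e | x≢y , inj₂ p with ∨-true p
...   | inj₁ old = x≢y , inj₁ (Edge-sym G old)
...   | inj₂ new = x≢y , inj₂ (inj₂ (==⇒≡ (proj₁ (∧-true new)) , proj₂ (∧-true new)))

contractEdge-old⁺ : ∀ {n} (G : Graph (suc n)) u v {x y} → Edge G (punchIn v x) (punchIn v y) →
                    Edge (contractEdge G u v) x y
contractEdge-old⁺ G u v e =
  mkSimple-edge⁺ (contractRel G u v) (λ eq → Edge-irrefl G e (cong (punchIn v) eq)) (inj₁ (∨-introˡ e))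

contractEdge-merged⁺ : ∀ {n} (G : Graph (suc n)) u v {x y} → x ≢ y → punchIn v x ≡ u →
                       Edge G v (punchIn v y) → Edge (contractEdge G u v) x y
contractEdge-merged⁺ G u v {x} x≢y refl e =
  mkSimple-edge⁺ (contractRel G u v) x≢y (inj₁ (∨-introʳ (subst (λ b → b ∧ _ ≡ true) (sym (==-refl (punchIn v x))) e)))

addEdge-edge⁻ : ∀ {n} (G : Graph n) u w {x y} → Edge (addEdge G u w) x y →
                Edge G x y ⊎ (x ≢ y × ((x ≡ u × y ≡ w) ⊎ (x ≡ w × y ≡ u)))
addEdge-edge⁻ G u w e with mkSimple-edge⁻ (addRel G u w) e
... | x≢y , inj₁ p with ∨-true p
...   | inj₁ old = inj₁ old
...   | inj₂ new = inj₂ (x≢y , inj₁ (==⇒≡ (proj₁ (∧-true new)) , ==⇒≡ (proj₂ (∧-true new))))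
addEdge-edge⁻ G u w e | x≢y , inj₂ p with ∨-true p
...   | inj₁ old = inj₁ (Edge-sym G old)
...   | inj₂ new = inj₂ (x≢y , inj₂ (==⇒≡ (proj₂ (∧-true new)) , ==⇒≡ (proj₁ (∧-true new))))

EdgeRel : ℕ → Set₁
EdgeRel n = Fin n → Fin n → Set

-- branch x = just i places x in branch set i; root i ∈ branch set i; every
-- other member of set i has an R-neighbour of smaller rank in set i (so the set
-- is connected); any two distinct sets are joined by an R-edge.
record K4Model {n : ℕ} (R : EdgeRel n) : Set where
  field
    branch : Fin n → Maybe (Fin 4)
    root   : Fin 4 → Fin n
    root∈  : ∀ i → branch (root i) ≡ just i
    rank   : Fin n → ℕ
    toRoot : ∀ x i → branch x ≡ just i →
             x ≡ root i ⊎ Σ (Fin n) λ y → branch y ≡ just i × R x y × rank y < rank x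
    touch  : ∀ i j → i ≢ j →
             Σ (Fin n) λ x → Σ (Fin n) λ y → branch x ≡ just i × branch y ≡ just j × R x y

K4Model-mono : ∀ {n} {R R′ : EdgeRel n} → (∀ x y → R x y → R′ x y) → K4Model R → K4Model R′
K4Model-mono {n} {R} {R′} R⊆R′ M = record
  { branch = branch ; root = root ; root∈ = root∈ ; rank = rank
  ; toRoot = λ x i bx → enlarge (toRoot x i bx)
  ; touch = λ i j i≢j → let (x , y , bx , by , e) = touch i j i≢j in x , y , bx , by , R⊆R′ x y e }
  where
  open K4Model M
  enlarge : ∀ {x i} → x ≡ root i ⊎ Σ (Fin n) (λ y → branch y ≡ just i × R x y × rank y < rank x)
          → x ≡ root i ⊎ Σ (Fin n) (λ y → branch y ≡ just i × R′ x y × rank y < rank x)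
  enlarge (inj₁ x≡root) = inj₁ x≡root
  enlarge (inj₂ (y , by , e , r)) = inj₂ (y , by , R⊆R′ _ y e , r)

branch-≢ : ∀ {n} {R : EdgeRel n} (M : K4Model R) {x y i j} →
           K4Model.branch M x ≡ just i → K4Model.branch M y ≡ just j → i ≢ j → x ≢ y
branch-≢ M bx by i≢j refl = i≢j (just-injective (trans (sym bx) by))

-- From a model to a minor: delete unused vertices, contract each non-root
-- member into its parent, and finally read off an isomorphism with K₄.

toPunched : ∀ {n} {x z : Fin (suc n)} (z≢x : z ≢ x) (P : Fin (suc n) → Set) →
            P z → P (punchIn x (punchOut′ z≢x))
toPunched z≢x P p = subst P (sym (punchIn-punchOut′ z≢x)) p

deleteUnused : ∀ {n} (G : Graph (suc n)) (M : K4Model (Edge G)) x →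
               K4Model.branch M x ≡ nothing → K4Model (Edge (deleteVertex G x))
deleteUnused {n} G M x x-unused = record
  { branch = λ y → branch (punchIn x y)
  ; root = λ i → punchOut′ (root≢x i)
  ; root∈ = λ i → toPunched (root≢x i) (λ w → branch w ≡ just i) (root∈ i)
  ; rank = λ y → rank (punchIn x y)
  ; toRoot = toRoot′
  ; touch = touch′ }
  where
  open K4Model M
  member≢x : ∀ {z i} → branch z ≡ just i → z ≢ x
  member≢x bz refl = just≢nothing (trans (sym bz) x-unused)
  root≢x : ∀ i → root i ≢ x
  root≢x i = member≢x (root∈ i)
  toRoot′ : ∀ y i → branch (punchIn x y) ≡ just i → y ≡ punchOut′ (root≢x i) ⊎
            Σ (Fin n) λ z → branch (punchIn x z) ≡ just i × Edge (deleteVertex G x) y z ×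
                            rank (punchIn x z) < rank (punchIn x y)
  toRoot′ y i by with toRoot (punchIn x y) i by
  ... | inj₁ eq = inj₁ (punchIn-injective x _ _ (trans eq (sym (punchIn-punchOut′ (root≢x i)))))
  ... | inj₂ (z , bz , e , r) =
    inj₂ (punchOut′ z≢x , toPunched z≢x (λ w → branch w ≡ just i) bz
         , deleteVertex-edge⁺ G x (toPunched z≢x (Edge G (punchIn x y)) e)
         , toPunched z≢x (λ w → rank w < rank (punchIn x y)) r)
    where z≢x = member≢x bz
  touch′ : ∀ i j → i ≢ j → Σ (Fin n) λ a → Σ (Fin n) λ b → branch (punchIn x a) ≡ just i ×
           branch (punchIn x b) ≡ just j × Edge (deleteVertex G x) a b
  touch′ i j i≢j with touch i j i≢j
  ... | a , b , ba , bb , e =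
    punchOut′ a≢x , punchOut′ b≢x
    , toPunched a≢x (λ w → branch w ≡ just i) ba
    , toPunched b≢x (λ w → branch w ≡ just j) bb
    , deleteVertex-edge⁺ G x
        (toPunched a≢x (λ w → Edge G w (punchIn x (punchOut′ b≢x))) (toPunched b≢x (Edge G a) e))
    where
    a≢x = member≢x ba
    b≢x = member≢x bb

contractIntoParent : ∀ {n} (G : Graph (suc n)) (M : K4Model (Edge G)) x y i →
  K4Model.branch M x ≡ just i → x ≢ K4Model.root M i → K4Model.branch M y ≡ just i →
  Edge G x y → K4Model.rank M y < K4Model.rank M x → K4Model (Edge (contractEdge G y x))
contractIntoParent {n} G M x y i bx x≢root by exy ry<rx = record
  { branch = λ z → branch (punchIn x z)
  ; root = λ j → punchOut′ (root≢x j)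
  ; root∈ = λ j → toPunched (root≢x j) (λ w → branch w ≡ just j) (root∈ j)
  ; rank = λ z → rank (punchIn x z)
  ; toRoot = toRoot′
  ; touch = touch′ }
  where
  open K4Model M
  G′ = contractEdge G y x
  root≢x : ∀ j → root j ≢ x
  root≢x j eq with just-injective (trans (sym (trans (cong branch (sym eq)) (root∈ j))) bx)
  ... | refl = x≢root (sym eq)
  y≢x : y ≢ x
  y≢x eq = Edge-irrefl G exy (sym eq)
  y′ = punchOut′ y≢x
  toRoot′ : ∀ z j → branch (punchIn x z) ≡ just j → z ≡ punchOut′ (root≢x j) ⊎
            Σ (Fin n) λ w → branch (punchIn x w) ≡ just j × Edge G′ z w ×
                            rank (punchIn x w) < rank (punchIn x z)
  toRoot′ z j bz with toRoot (punchIn x z) j bz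
  ... | inj₁ eq = inj₁ (punchIn-injective x _ _ (trans eq (sym (punchIn-punchOut′ (root≢x j)))))
  ... | inj₂ (q , bq , e , r) with q ≟ x
  ...   | no q≢x = inj₂ (punchOut′ q≢x , toPunched q≢x (λ w → branch w ≡ just j) bq
                        , contractEdge-old⁺ G y x (toPunched q≢x (Edge G (punchIn x z)) e)
                        , toPunched q≢x (λ w → rank w < rank (punchIn x z)) r)
  ...   | yes refl with just-injective (trans (sym bx) bq)
  ...     | refl = inj₂ (y′ , toPunched y≢x (λ w → branch w ≡ just i) by
                        , Edge-sym G′ (contractEdge-merged⁺ G y x y′≢z (punchIn-punchOut′ y≢x) (Edge-sym G e))
                        , toPunched y≢x (λ w → rank w < rank (punchIn x z)) (<-trans ry<rx r))
    where
    y′≢z : y′ ≢ z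
    y′≢z eq = <-irrefl refl (<-trans ry<rx (subst (λ w → rank x < rank w)
                (trans (cong (punchIn x) (sym eq)) (punchIn-punchOut′ y≢x)) r))
  touch′ : ∀ j k → j ≢ k → Σ (Fin n) λ a → Σ (Fin n) λ b → branch (punchIn x a) ≡ just j ×
           branch (punchIn x b) ≡ just k × Edge G′ a b
  touch′ j k j≢k with touch j k j≢k
  ... | a , b , ba , bb , e with a ≟ x | b ≟ x
  ...   | no a≢x | no b≢x =
    punchOut′ a≢x , punchOut′ b≢x
    , toPunched a≢x (λ w → branch w ≡ just j) ba , toPunched b≢x (λ w → branch w ≡ just k) bb
    , contractEdge-old⁺ G y x
        (toPunched a≢x (λ w → Edge G w (punchIn x (punchOut′ b≢x))) (toPunched b≢x (Edge G a) e))
  ...   | yes refl | yes refl = ⊥-elim (j≢k (just-injective (trans (sym ba) bb)))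
  ...   | yes refl | no b≢x with just-injective (trans (sym bx) ba)
  ...     | refl = y′ , punchOut′ b≢x
                 , toPunched y≢x (λ w → branch w ≡ just i) by , toPunched b≢x (λ w → branch w ≡ just k) bb
                 , contractEdge-merged⁺ G y x y′≢b′ (punchIn-punchOut′ y≢x) (toPunched b≢x (Edge G x) e)
    where
    y′≢b′ : y′ ≢ punchOut′ b≢x
    y′≢b′ eq = branch-≢ M by bb j≢k
      (trans (sym (punchIn-punchOut′ y≢x)) (trans (cong (punchIn x) eq) (punchIn-punchOut′ b≢x)))
  touch′ j k j≢k | a , b , ba , bb , e | no a≢x | yes refl with just-injective (trans (sym bx) bb)
  ...     | refl = punchOut′ a≢x , y′
                 , toPunched a≢x (λ w → branch w ≡ just j) ba , toPunched y≢x (λ w → branch w ≡ just i) by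
                 , Edge-sym G′ (contractEdge-merged⁺ G y x y′≢a′ (punchIn-punchOut′ y≢x)
                                  (toPunched a≢x (Edge G x) (Edge-sym G e)))
    where
    y′≢a′ : y′ ≢ punchOut′ a≢x
    y′≢a′ eq = branch-≢ M ba by j≢k
      (trans (sym (punchIn-punchOut′ a≢x)) (trans (cong (punchIn x) (sym eq)) (punchIn-punchOut′ y≢x)))

IsRoot : ∀ {n} {R : EdgeRel n} → K4Model R → Fin n → Set
IsRoot M x = Σ (Fin 4) λ i → K4Model.branch M x ≡ just i × x ≡ K4Model.root M i

data Kind {n} {R : EdgeRel n} (M : K4Model R) (x : Fin n) : Set where
  unused    : K4Model.branch M x ≡ nothing → Kind M x
  nonRoot   : ∀ i → K4Model.branch M x ≡ just i → x ≢ K4Model.root M i → Kind M x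
  rootKind  : IsRoot M x → Kind M x

kind : ∀ {n} {R : EdgeRel n} (M : K4Model R) x → Kind M x
kind M x with K4Model.branch M x in bx
... | nothing = unused bx
... | just i with x ≟ K4Model.root M i
...   | yes x≡root = rootKind (i , bx , x≡root)
...   | no x≢root = nonRoot i bx x≢root

isRoot? : ∀ {n} {R : EdgeRel n} (M : K4Model R) x → Dec (IsRoot M x)
isRoot? M x with kind M x
... | unused bx = no λ (i , bx′ , _) → just≢nothing (trans (sym bx′) bx)
... | nonRoot i bx x≢root = no λ (i′ , bx′ , x≡root) →
        x≢root (subst (λ k → x ≡ K4Model.root M k) (just-injective (trans (sym bx′) bx)) x≡root)
... | rootKind r = yes r

allRoots⇒iso : ∀ {n} (G : Graph n) (M : K4Model (Edge G)) → (∀ x → IsRoot M x) → K4 ≅ G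
allRoots⇒iso {n} G M allRoot = mk↔ₛ′ root index root-index index-root , edges
  where
  open K4Model M
  index : Fin n → Fin 4
  index x = proj₁ (allRoot x)
  root-index : ∀ x → root (index x) ≡ x
  root-index x = sym (proj₂ (proj₂ (allRoot x)))
  index-root : ∀ i → index (root i) ≡ i
  index-root i = just-injective (trans (sym (proj₁ (proj₂ (allRoot (root i))))) (root∈ i))
  root-of : ∀ {x i} → branch x ≡ just i → x ≡ root i
  root-of {x} bx = trans (sym (root-index x))
                         (cong root (just-injective (trans (sym (proj₁ (proj₂ (allRoot x)))) bx)))
  edges : ∀ a b → adj G (root a) (root b) ≡ adj K4 a b
  edges a b with a ≟ b
  ... | yes refl = irrefl G (root a)
  ... | no a≢b with touch a b a≢b
  ...   | x , y , bx , by , e = subst₂ (Edge G) (root-of bx) (root-of by) e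

model⇒minor : ∀ {n} (G : Graph n) → K4Model (Edge G) → K4 ≼ G
model⇒minor {zero} G M with K4Model.root M zero
... | ()
model⇒minor {suc n} G M with any? (λ x → ¬? (isRoot? M x))
... | no noNonRoot =
  done (allRoots⇒iso G M (λ x → decidable-stable (isRoot? M x) (λ ¬r → noNonRoot (x , ¬r))))
... | yes (x , ¬root) with kind M x
...   | unused bx = delVertex x (model⇒minor (deleteVertex G x) (deleteUnused G M x bx))
...   | rootKind r = ⊥-elim (¬root r)
...   | nonRoot i bx x≢root with K4Model.toRoot M x i bx
...     | inj₁ x≡root = ⊥-elim (x≢root x≡root)
...     | inj₂ (y , by , exy , ry<rx) =
  contract y x (Edge-sym G exy) (model⇒minor (contractEdge G y x) (contractIntoParent G M x y i bx x≢root by exy ry<rx))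

extendAt : ∀ {n} {A : Set} (v : Fin (suc n)) → (Fin n → A) → A → Fin (suc n) → A
extendAt v g d x with x ≟ v
... | yes _ = d
... | no x≢v = g (punchOut′ x≢v)

extendAt-punchIn : ∀ {n} {A : Set} (v : Fin (suc n)) (g : Fin n → A) d y →
                   extendAt v g d (punchIn v y) ≡ g y
extendAt-punchIn v g d y with punchIn v y ≟ v
... | yes eq = ⊥-elim (punchInᵢ≢i v y eq)
... | no _ = cong g (trans (punchOut-cong v refl) (punchOut-punchIn v))

extendAt-v : ∀ {n} {A : Set} (v : Fin (suc n)) (g : Fin n → A) d → extendAt v g d v ≡ d
extendAt-v v g d with v ≟ v
... | yes _ = refl
... | no v≢v = ⊥-elim (v≢v refl)

-- An isomorphism K₄ ≅ G is a model with singleton branch sets.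
iso⇒model : ∀ {n} (G : Graph n) → K4 ≅ G → K4Model (Edge G)
iso⇒model G (φ , edges) = record
  { branch = λ x → just (from x) ; root = to ; root∈ = λ i → cong just (strictlyInverseʳ i)
  ; rank = λ _ → 0
  ; toRoot = λ x i bx → inj₁ (trans (sym (strictlyInverseˡ x)) (cong to (just-injective bx)))
  ; touch = λ i j i≢j → to i , to j , cong just (strictlyInverseʳ i) , cong just (strictlyInverseʳ j)
                      , trans (edges i j) (K4-edge i≢j) }
  where open Inverse φ

-- A model of G - v is a model of G, with v unused.
undeleteVertex : ∀ {n} (G : Graph (suc n)) v → K4Model (Edge (deleteVertex G v)) → K4Model (Edge G)
undeleteVertex {n} G v M′ = record
  { branch = B ; root = λ i → punchIn v (root′ i)
  ; root∈ = λ i → trans (extendAt-punchIn v branch′ nothing (root′ i)) (root∈′ i)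
  ; rank = Rk ; toRoot = toRoot″ ; touch = touch″ }
  where
  open K4Model M′ renaming (branch to branch′; root to root′; root∈ to root∈′; rank to rank′;
                             toRoot to toRoot′; touch to touch′)
  B = extendAt v branch′ nothing
  Rk = extendAt v rank′ 0
  B-in : ∀ y → B (punchIn v y) ≡ branch′ y
  B-in = extendAt-punchIn v branch′ nothing
  Rk-in : ∀ y → Rk (punchIn v y) ≡ rank′ y
  Rk-in = extendAt-punchIn v rank′ 0
  toRoot″ : ∀ x i → B x ≡ just i → x ≡ punchIn v (root′ i) ⊎
            Σ (Fin (suc n)) λ y → B y ≡ just i × Edge G x y × Rk y < Rk x
  toRoot″ x i bx with punchIn-cases v x
  ... | inj₁ refl = ⊥-elim (just≢nothing (trans (sym bx) (extendAt-v v branch′ nothing)))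
  ... | inj₂ (y , refl) with toRoot′ y i (trans (sym (B-in y)) bx)
  ...   | inj₁ eq = inj₁ (cong (punchIn v) eq)
  ...   | inj₂ (z , bz , e , r) = inj₂ (punchIn v z , trans (B-in z) bz , deleteVertex-edge⁻ G v e
                                       , subst₂ _<_ (sym (Rk-in z)) (sym (Rk-in y)) r)
  touch″ : ∀ i j → i ≢ j → Σ (Fin (suc n)) λ a → Σ (Fin (suc n)) λ b → B a ≡ just i × B b ≡ just j × Edge G a b
  touch″ i j i≢j with touch′ i j i≢j
  ... | a , b , ba , bb , e = punchIn v a , punchIn v b , trans (B-in a) ba , trans (B-in b) bb
                            , deleteVertex-edge⁻ G v e

-- Doubling leaves room for one extra rank between consecutive ranks.
double : ℕ → ℕ
double a = a + a

double-< : ∀ {a b} → a < b → suc (suc (double a)) ≤ double b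
double-< {a} {suc b} (s≤s a≤b) rewrite +-suc b b = s≤s (s≤s (+-mono-≤ a≤b a≤b))

-- A model of G / uv (v merged into u) is a model of G: v joins the branch set
-- of u.  Old ranks are doubled and shifted by two; v gets an odd rank just
-- below or above u, depending on whether u reached its parent through v.
module Uncontract {n} (G : Graph (suc n)) (u v : Fin (suc n)) (euv : Edge G u v)
                  (M′ : K4Model (Edge (contractEdge G u v))) where
  open K4Model M′ renaming (branch to branch′; root to root′; root∈ to root∈′; rank to rank′;
                             toRoot to toRoot′; touch to touch′)
  u≢v : u ≢ v
  u≢v = Edge-irrefl G euv
  u′ = punchOut′ u≢v
  pu : punchIn v u′ ≡ u
  pu = punchIn-punchOut′ u≢v

  data UPlace : Set where
    unused : branch′ u′ ≡ nothing → UPlace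
    isRoot : ∀ i → branch′ u′ ≡ just i → u′ ≡ root′ i → UPlace
    direct : ∀ i p → branch′ u′ ≡ just i → branch′ p ≡ just i → Edge G u (punchIn v p) →
             rank′ p < rank′ u′ → UPlace
    viaV   : ∀ i p → branch′ u′ ≡ just i → branch′ p ≡ just i → Edge G v (punchIn v p) →
             rank′ p < rank′ u′ → UPlace

  uPlace : UPlace
  uPlace with branch′ u′ in bu
  ... | nothing = unused bu
  ... | just i with toRoot′ u′ i bu
  ...   | inj₁ r = isRoot i bu r
  ...   | inj₂ (p , bp , ep , rp) with contractEdge-edge⁻ G u v ep
  ...     | _ , inj₁ old = direct i p bu bp (subst (λ w → Edge G w (punchIn v p)) pu old) rp
  ...     | _ , inj₂ (inj₁ (_ , new)) = viaV i p bu bp new rp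
  ...     | _ , inj₂ (inj₂ (q , _)) =
    ⊥-elim (<-irrefl (cong rank′ (punchIn-injective v _ _ (trans q (sym pu)))) rp)

  rankOld : Fin n → ℕ
  rankOld y = suc (suc (double (rank′ y)))

  rankV : UPlace → ℕ
  rankV (unused _) = 0
  rankV (isRoot _ _ _) = suc (suc (suc (double (rank′ u′))))
  rankV (direct _ _ _ _ _ _) = suc (suc (suc (double (rank′ u′))))
  rankV (viaV _ _ _ _ _ _) = suc (double (rank′ u′))

  rankV≤ : ∀ pl → rankV pl ≤ suc (suc (suc (double (rank′ u′))))
  rankV≤ (unused _) = z≤n
  rankV≤ (isRoot _ _ _) = ≤-refl
  rankV≤ (direct _ _ _ _ _ _) = ≤-refl
  rankV≤ (viaV _ _ _ _ _ _) = m≤n⇒m≤1+n (m≤n⇒m≤1+n ≤-refl)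

  rankOld-< : ∀ {a b} → rank′ a < rank′ b → rankOld a < rankOld b
  rankOld-< r = s≤s (s≤s (≤-trans (n≤1+n _) (double-< r)))

  B : Fin (suc n) → Maybe (Fin 4)
  B = extendAt v branch′ (branch′ u′)
  Rk : Fin (suc n) → ℕ
  Rk = extendAt v rankOld (rankV uPlace)
  B-in : ∀ y → B (punchIn v y) ≡ branch′ y
  B-in = extendAt-punchIn v branch′ (branch′ u′)
  B-v : B v ≡ branch′ u′
  B-v = extendAt-v v branch′ (branch′ u′)
  Rk-in : ∀ y → Rk (punchIn v y) ≡ rankOld y
  Rk-in = extendAt-punchIn v rankOld (rankV uPlace)
  Rk-v : Rk v ≡ rankV uPlace
  Rk-v = extendAt-v v rankOld (rankV uPlace)

  Parent : Fin (suc n) → Fin 4 → Set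
  Parent x i = Σ (Fin (suc n)) λ y → B y ≡ just i × Edge G x y × Rk y < Rk x

  -- v's parent is u, or the parent p of u′ when u′ reached p through v.
  parentV : ∀ i pl → Rk v ≡ rankV pl → branch′ u′ ≡ just i → Parent v i
  parentV i (unused bu′) _ bu = ⊥-elim (just≢nothing (trans (sym bu) bu′))
  parentV i (isRoot _ _ _) rv bu =
    punchIn v u′ , trans (B-in u′) bu , subst (Edge G v) (sym pu) (Edge-sym G euv)
    , subst₂ _<_ (sym (Rk-in u′)) (sym rv) (n<1+n _)
  parentV i (direct _ _ _ _ _ _) rv bu =
    punchIn v u′ , trans (B-in u′) bu , subst (Edge G v) (sym pu) (Edge-sym G euv)
    , subst₂ _<_ (sym (Rk-in u′)) (sym rv) (n<1+n _)
  parentV i (viaV i′ p bu′ bp ep rp) rv bu with just-injective (trans (sym bu′) bu)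
  ... | refl = punchIn v p , trans (B-in p) bp , ep , subst₂ _<_ (sym (Rk-in p)) (sym rv) (s≤s (double-< rp))

  parentU : ∀ i pl → Rk v ≡ rankV pl → branch′ u′ ≡ just i →
            punchIn v u′ ≡ punchIn v (root′ i) ⊎ Parent (punchIn v u′) i
  parentU i (unused bu′) _ bu = ⊥-elim (just≢nothing (trans (sym bu) bu′))
  parentU i (isRoot i′ bu′ r) _ bu with just-injective (trans (sym bu′) bu)
  ... | refl = inj₁ (cong (punchIn v) r)
  parentU i (direct i′ p bu′ bp ep rp) _ bu with just-injective (trans (sym bu′) bu)
  ... | refl = inj₂ (punchIn v p , trans (B-in p) bp , subst (λ w → Edge G w (punchIn v p)) (sym pu) ep
                    , subst₂ _<_ (sym (Rk-in p)) (sym (Rk-in u′)) (rankOld-< rp))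
  parentU i (viaV i′ p bu′ bp ep rp) rv bu with just-injective (trans (sym bu′) bu)
  ... | refl = inj₂ (v , trans B-v bu , subst (λ w → Edge G w v) (sym pu) euv
                    , subst₂ _<_ (sym rv) (sym (Rk-in u′)) (n<1+n _))

  toRoot″ : ∀ x i → B x ≡ just i → x ≡ punchIn v (root′ i) ⊎ Parent x i
  toRoot″ x i bx with punchIn-cases v x
  ... | inj₁ refl = inj₂ (parentV i uPlace Rk-v (trans (sym B-v) bx))
  ... | inj₂ (y , refl) with y ≟ u′
  ...   | yes refl = parentU i uPlace Rk-v (trans (sym (B-in u′)) bx)
  ...   | no y≢u′ with toRoot′ y i (trans (sym (B-in y)) bx)
  ...     | inj₁ r = inj₁ (cong (punchIn v) r)
  ...     | inj₂ (p , bp , ep , rp) with contractEdge-edge⁻ G u v ep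
  ...       | _ , inj₁ old = inj₂ (punchIn v p , trans (B-in p) bp , old
                                  , subst₂ _<_ (sym (Rk-in p)) (sym (Rk-in y)) (rankOld-< rp))
  ...       | _ , inj₂ (inj₁ (q , _)) = ⊥-elim (y≢u′ (punchIn-injective v _ _ (trans q (sym pu))))
  ...       | _ , inj₂ (inj₂ (q , new)) with punchIn-injective v _ _ (trans q (sym pu))
  ...         | refl = inj₂ (v , trans B-v bp , Edge-sym G new
                             , subst₂ _<_ (sym Rk-v) (sym (Rk-in y))
                                 (≤-<-trans (rankV≤ uPlace) (s≤s (s≤s (double-< rp)))))

  touch″ : ∀ i j → i ≢ j → Σ (Fin (suc n)) λ a → Σ (Fin (suc n)) λ b → B a ≡ just i × B b ≡ just j × Edge G a b
  touch″ i j i≢j with touch′ i j i≢j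
  ... | a , b , ba , bb , eab with contractEdge-edge⁻ G u v eab
  ...   | _ , inj₁ old = punchIn v a , punchIn v b , trans (B-in a) ba , trans (B-in b) bb , old
  ...   | _ , inj₂ (inj₁ (q , new)) with punchIn-injective v _ _ (trans q (sym pu))
  ...     | refl = v , punchIn v b , trans B-v ba , trans (B-in b) bb , new
  touch″ i j i≢j | a , b , ba , bb , eab | _ , inj₂ (inj₂ (q , new)) with punchIn-injective v _ _ (trans q (sym pu))
  ...     | refl = punchIn v a , v , trans (B-in a) ba , trans B-v bb , Edge-sym G new

  model : K4Model (Edge G)
  model = record { branch = B ; root = λ i → punchIn v (root′ i)
                 ; root∈ = λ i → trans (B-in (root′ i)) (root∈′ i)
                 ; rank = Rk ; toRoot = toRoot″ ; touch = touch″ }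

minor⇒model : ∀ {n} {G : Graph n} → K4 ≼ G → K4Model (Edge G)
minor⇒model {G = G} (done iso) = iso⇒model G iso
minor⇒model {G = G} (delEdge u v _ m) = K4Model-mono (λ x y → deleteEdge-edge⁻ G u v) (minor⇒model m)
minor⇒model {G = G} (delVertex v m) = undeleteVertex G v (minor⇒model m)
minor⇒model {G = G} (contract u v e m) = Uncontract.model G u v e (minor⇒model m)

Symmetric Irreflexive : ∀ {n} → EdgeRel n → Set
Symmetric R = ∀ {x y} → R x y → R y x
Irreflexive R = ∀ {x y} → R x y → x ≢ y

OneOf : ∀ {n} → Fin n → Fin n → Fin n → Set
OneOf a b x = x ≡ a ⊎ x ≡ b

Link : ∀ {n} → Fin n → Fin n → EdgeRel n
Link a b x y = x ≢ y × ((x ≡ a × y ≡ b) ⊎ (x ≡ b × y ≡ a))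

Without : ∀ {n} → EdgeRel n → Fin n → EdgeRel n
Without R v x y = R x y × x ≢ v × y ≢ v

Join : ∀ {n} → EdgeRel n → Fin n → Fin n → EdgeRel n
Join R a b x y = R x y ⊎ Link a b x y

Suppress : ∀ {n} → EdgeRel n → Fin n → Fin n → Fin n → EdgeRel n
Suppress R v a b = Join (Without R v) a b

Link-intro : ∀ {n} {a b x y : Fin n} → OneOf a b x → OneOf a b y → x ≢ y → Link a b x y
Link-intro (inj₁ refl) (inj₁ refl) x≢y = ⊥-elim (x≢y refl)
Link-intro (inj₁ refl) (inj₂ refl) x≢y = x≢y , inj₁ (refl , refl)
Link-intro (inj₂ refl) (inj₁ refl) x≢y = x≢y , inj₂ (refl , refl)
Link-intro (inj₂ refl) (inj₂ refl) x≢y = ⊥-elim (x≢y refl)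

Link-ends : ∀ {n} {a b x y : Fin n} → Link a b x y → OneOf a b x × OneOf a b y
Link-ends (_ , inj₁ (x≡a , y≡b)) = inj₁ x≡a , inj₂ y≡b
Link-ends (_ , inj₂ (x≡b , y≡a)) = inj₂ x≡b , inj₁ y≡a

Link-loop : ∀ {n} {a x y : Fin n} → ¬ Link a a x y
Link-loop (x≢y , inj₁ (refl , refl)) = x≢y refl
Link-loop (x≢y , inj₂ (refl , refl)) = x≢y refl

Link-sym : ∀ {n} {a b : Fin n} → Symmetric (Link a b)
Link-sym (x≢y , inj₁ (p , q)) = (λ e → x≢y (sym e)) , inj₂ (q , p)
Link-sym (x≢y , inj₂ (p , q)) = (λ e → x≢y (sym e)) , inj₁ (q , p)

Link⇒edge : ∀ {n} {R : EdgeRel n} {a b x y} → Symmetric R → R a b → Link a b x y → R x y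
Link⇒edge R-sym eab (_ , inj₁ (refl , refl)) = eab
Link⇒edge R-sym eab (_ , inj₂ (refl , refl)) = R-sym eab

Join-sym : ∀ {n} {R : EdgeRel n} {a b} → Symmetric R → Symmetric (Join R a b)
Join-sym R-sym (inj₁ e) = inj₁ (R-sym e)
Join-sym R-sym (inj₂ l) = inj₂ (Link-sym l)

Without-sym : ∀ {n} {R : EdgeRel n} {v} → Symmetric R → Symmetric (Without R v)
Without-sym R-sym (e , x≢v , y≢v) = R-sym e , y≢v , x≢v

Join-avoiding : ∀ {n} {R : EdgeRel n} {v w x y} → Join R v w x y → x ≢ v → y ≢ v → R x y
Join-avoiding (inj₁ e) _ _ = e
Join-avoiding (inj₂ (_ , inj₁ (x≡v , _))) x≢v _ = ⊥-elim (x≢v x≡v)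
Join-avoiding (inj₂ (_ , inj₂ (_ , y≡v))) _ y≢v = ⊥-elim (y≢v y≡v)

singletonBranch : ∀ {n} {R : EdgeRel n} (M : K4Model R) v i → K4Model.root M i ≡ v →
  (∀ x → K4Model.branch M x ≡ just i → ¬ R x v) → ∀ x → K4Model.branch M x ≡ just i → x ≡ v
singletonBranch {R = R} M v i root≡v noEdge x = below (suc (rank x)) x ≤-refl
  where
  open K4Model M
  below : ∀ k x → rank x < k → branch x ≡ just i → x ≡ v
  below (suc k) x (s≤s r) bx with toRoot x i bx
  ... | inj₁ x≡root = trans x≡root root≡v
  ... | inj₂ (y , by , e , ry) = ⊥-elim (noEdge x bx (subst (R x) (below k y (<-≤-trans ry r) by) e))

anotherIndex : Fin 4 → Fin 4
anotherIndex zero = suc zero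
anotherIndex (suc _) = zero

anotherIndex≢ : ∀ i → i ≢ anotherIndex i
anotherIndex≢ zero ()
anotherIndex≢ (suc i) ()

-- A vertex without neighbours belongs to no branch set: its set would have to
-- be {v}, which touches no other set.
isolated⇒unused : ∀ {n} {R : EdgeRel n} (M : K4Model R) v →
                  (∀ y → ¬ R v y) → (∀ y → ¬ R y v) → K4Model.branch M v ≡ nothing
isolated⇒unused {R = R} M v noOut noIn with K4Model.branch M v in bv
... | nothing = refl
... | just i =
  let (x , y , bx , _ , e) = touch i (anotherIndex i) (anotherIndex≢ i) in
  ⊥-elim (noOut y (subst (λ w → R w y) (singletonBranch M v i root≡v (λ x _ → noIn x) x bx) e))
  where
  open K4Model M
  root≡v : root i ≡ v
  root≡v with toRoot v i bv
  ... | inj₁ eq = sym eq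
  ... | inj₂ (y , _ , e , _) = ⊥-elim (noOut y e)

noThreeInTwo : ∀ {j₁ j₂ j₃ : Fin 4} {A B : Maybe (Fin 4)} → j₁ ≢ j₂ → j₁ ≢ j₃ → j₂ ≢ j₃ →
  (just j₁ ≡ A ⊎ just j₁ ≡ B) → (just j₂ ≡ A ⊎ just j₂ ≡ B) → (just j₃ ≡ A ⊎ just j₃ ≡ B) → ⊥
noThreeInTwo n12 n13 n23 (inj₁ p) (inj₁ q) _ = n12 (just-injective (trans p (sym q)))
noThreeInTwo n12 n13 n23 (inj₂ p) (inj₂ q) _ = n12 (just-injective (trans p (sym q)))
noThreeInTwo n12 n13 n23 (inj₁ p) (inj₂ q) (inj₁ r) = n13 (just-injective (trans p (sym r)))
noThreeInTwo n12 n13 n23 (inj₁ p) (inj₂ q) (inj₂ r) = n23 (just-injective (trans q (sym r)))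
noThreeInTwo n12 n13 n23 (inj₂ p) (inj₁ q) (inj₁ r) = n23 (just-injective (trans q (sym r)))
noThreeInTwo n12 n13 n23 (inj₂ p) (inj₁ q) (inj₂ r) = n13 (just-injective (trans p (sym r)))

othersNotInTwo : ∀ (i : Fin 4) {A B : Maybe (Fin 4)} → ¬ (∀ j → i ≢ j → just j ≡ A ⊎ just j ≡ B)
othersNotInTwo zero h =
  noThreeInTwo (λ ()) (λ ()) (λ ()) (h (suc zero) (λ ())) (h (suc (suc zero)) (λ ())) (h (suc (suc (suc zero))) (λ ()))
othersNotInTwo (suc zero) h =
  noThreeInTwo (λ ()) (λ ()) (λ ()) (h zero (λ ())) (h (suc (suc zero)) (λ ())) (h (suc (suc (suc zero))) (λ ()))
othersNotInTwo (suc (suc zero)) h =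
  noThreeInTwo (λ ()) (λ ()) (λ ()) (h zero (λ ())) (h (suc zero) (λ ())) (h (suc (suc (suc zero))) (λ ()))
othersNotInTwo (suc (suc (suc zero))) h =
  noThreeInTwo (λ ()) (λ ()) (λ ()) (h zero (λ ())) (h (suc zero) (λ ())) (h (suc (suc zero)) (λ ()))

-- If v lies in
-- set i, then a or b lies in set i as well (otherwise set i = {v} could touch
-- the three other sets only through a and b); v is dropped from its set and the
-- new edge ab takes over the role of the edges at v.
module SuppressModel {n} (R : EdgeRel n) (R-sym : Symmetric R) (v a b : Fin n)
                     (a≢v : a ≢ v) (b≢v : b ≢ v) (nbrs : ∀ y → R v y → OneOf a b y)
                     (M : K4Model R) where
  open K4Model M

  R′ = Suppress R v a b

  OneOf⇒≢v : ∀ {y} → OneOf a b y → y ≢ v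
  OneOf⇒≢v (inj₁ refl) = a≢v
  OneOf⇒≢v (inj₂ refl) = b≢v

  branch⁻ : Fin n → Maybe (Fin 4)
  branch⁻ x with x ≟ v
  ... | yes _ = nothing
  ... | no _ = branch x

  branch⁻-≢v : ∀ {x} → x ≢ v → branch⁻ x ≡ branch x
  branch⁻-≢v {x} x≢v with x ≟ v
  ... | yes x≡v = ⊥-elim (x≢v x≡v)
  ... | no _ = refl

  branch⁻-just : ∀ {x j} → branch⁻ x ≡ just j → x ≢ v × branch x ≡ just j
  branch⁻-just {x} bx with x ≟ v
  ... | yes _ = ⊥-elim (just≢nothing (sym bx))
  ... | no x≢v = x≢v , bx

  Touching : (Fin n → Maybe (Fin 4)) → Set
  Touching B = ∀ j k → j ≢ k → Σ (Fin n) λ x → Σ (Fin n) λ y → B x ≡ just j × B y ≡ just k × R′ x y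

  -- With an anchor o ∈ {a,b} in the set of v, an edge at v is replaced by an
  -- edge at o.
  touchVia : ∀ i → branch v ≡ just i → ∀ o → OneOf a b o → branch o ≡ just i → Touching branch⁻
  touchVia i bv o o∈ab bo j k j≢k with touch j k j≢k
  ... | x , y , bx , by , e with x ≟ v | y ≟ v
  ...   | no x≢v | no y≢v =
    x , y , trans (branch⁻-≢v x≢v) bx , trans (branch⁻-≢v y≢v) by , inj₁ (e , x≢v , y≢v)
  ...   | yes refl | _ with just-injective (trans (sym bv) bx)
  ...     | refl = o , y , trans (branch⁻-≢v (OneOf⇒≢v o∈ab)) bo
                 , trans (branch⁻-≢v (branch-≢ M by bv (λ eq → j≢k (sym eq)))) by
                 , inj₂ (Link-intro o∈ab (nbrs y e) (branch-≢ M bo by j≢k))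
  touchVia i bv o o∈ab bo j k j≢k | x , y , bx , by , e | no x≢v | yes refl with just-injective (trans (sym bv) by)
  ...     | refl = x , o , trans (branch⁻-≢v x≢v) bx , trans (branch⁻-≢v (OneOf⇒≢v o∈ab)) bo
                 , inj₂ (Link-intro (nbrs x (R-sym e)) o∈ab (branch-≢ M bx bo j≢k))

  whenUnused : branch v ≡ nothing → K4Model R′
  whenUnused bv = record { branch = branch ; root = root ; root∈ = root∈ ; rank = rank
                         ; toRoot = toRoot′ ; touch = touch′ }
    where
    member≢v : ∀ {x j} → branch x ≡ just j → x ≢ v
    member≢v bx refl = just≢nothing (trans (sym bx) bv)
    toRoot′ : ∀ x j → branch x ≡ just j →
              x ≡ root j ⊎ Σ (Fin n) λ y → branch y ≡ just j × R′ x y × rank y < rank x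
    toRoot′ x j bx with toRoot x j bx
    ... | inj₁ r = inj₁ r
    ... | inj₂ (y , by , e , r) = inj₂ (y , by , inj₁ (e , member≢v bx , member≢v by) , r)
    touch′ : Touching branch
    touch′ j k j≢k with touch j k j≢k
    ... | x , y , bx , by , e = x , y , bx , by , inj₁ (e , member≢v bx , member≢v by)

  -- v is a non-root member: its parent o ∈ {a,b} adopts the children of v.
  whenNonRoot : ∀ i → branch v ≡ just i → root i ≢ v → K4Model R′
  whenNonRoot i bv root≢v with toRoot v i bv
  ... | inj₁ eq = ⊥-elim (root≢v (sym eq))
  ... | inj₂ (o , bo , evo , ro) = record
    { branch = branch⁻ ; root = root ; root∈ = λ j → trans (branch⁻-≢v (roots≢v j)) (root∈ j)
    ; rank = rank ; toRoot = toRoot′ ; touch = touchVia i bv o o∈ab bo }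
    where
    o∈ab = nbrs o evo
    roots≢v : ∀ j → root j ≢ v
    roots≢v j eq with just-injective (trans (sym (root∈ j)) (trans (cong branch eq) bv))
    ... | refl = root≢v eq
    toRoot′ : ∀ x j → branch⁻ x ≡ just j →
              x ≡ root j ⊎ Σ (Fin n) λ y → branch⁻ y ≡ just j × R′ x y × rank y < rank x
    toRoot′ x j bx⁻ with branch⁻-just bx⁻
    ... | x≢v , bx with toRoot x j bx
    ...   | inj₁ r = inj₁ r
    ...   | inj₂ (y , by , e , r) with y ≟ v
    ...     | no y≢v = inj₂ (y , trans (branch⁻-≢v y≢v) by , inj₁ (e , x≢v , y≢v) , r)
    ...     | yes refl with just-injective (trans (sym bv) by)
    ...       | refl = inj₂ (o , trans (branch⁻-≢v (OneOf⇒≢v o∈ab)) bo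
                           , inj₂ (Link-intro (nbrs x (R-sym e)) o∈ab x≢o) , <-trans ro r)
      where
      x≢o : x ≢ o
      x≢o refl = <-irrefl refl (<-trans ro r)

  -- v is the root of set i and c ∈ {a,b} lies in set i: c becomes the root, with rank 0.
  whenRoot : ∀ i → branch v ≡ just i → root i ≡ v → ∀ c → OneOf a b c → branch c ≡ just i → K4Model R′
  whenRoot i bv root≡v c c∈ab bc = record
    { branch = branch⁻ ; root = root⁺ ; root∈ = root⁺∈ ; rank = rank⁺ ; toRoot = toRoot′
    ; touch = touchVia i bv c c∈ab bc }
    where
    c≢v = OneOf⇒≢v c∈ab
    root⁺ : Fin 4 → Fin n
    root⁺ j with j ≟ i
    ... | yes _ = c
    ... | no _ = root j
    root⁺∈ : ∀ j → branch⁻ (root⁺ j) ≡ just j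
    root⁺∈ j with j ≟ i
    ... | yes refl = trans (branch⁻-≢v c≢v) bc
    ... | no j≢i = trans (branch⁻-≢v root≢v) (root∈ j)
      where
      root≢v : root j ≢ v
      root≢v eq = j≢i (just-injective (trans (sym (root∈ j)) (trans (cong branch eq) bv)))
    rank⁺ : Fin n → ℕ
    rank⁺ x with x ≟ c
    ... | yes _ = 0
    ... | no _ = rank x
    rank⁺≤ : ∀ x → rank⁺ x ≤ rank x
    rank⁺≤ x with x ≟ c
    ... | yes _ = z≤n
    ... | no _ = ≤-refl
    rank⁺-c : rank⁺ c ≡ 0
    rank⁺-c with c ≟ c
    ... | yes _ = refl
    ... | no c≢c = ⊥-elim (c≢c refl)
    root⁺-i : ∀ {j} → j ≡ i → root⁺ j ≡ c
    root⁺-i {j} j≡i with j ≟ i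
    ... | yes _ = refl
    ... | no j≢i = ⊥-elim (j≢i j≡i)
    toRoot′ : ∀ x j → branch⁻ x ≡ just j →
              x ≡ root⁺ j ⊎ Σ (Fin n) λ y → branch⁻ y ≡ just j × R′ x y × rank⁺ y < rank⁺ x
    toRoot′ x j bx⁻ with branch⁻-just bx⁻
    ... | x≢v , bx with x ≟ c
    ...   | yes refl = inj₁ (sym (root⁺-i (just-injective (trans (sym bx) bc))))
    ...   | no x≢c with toRoot x j bx
    ...     | inj₁ r with j ≟ i
    ...       | yes refl = ⊥-elim (x≢v (trans r root≡v))
    ...       | no _ = inj₁ r
    toRoot′ x j bx⁻ | x≢v , bx | no x≢c | inj₂ (y , by , e , r) with y ≟ v
    ...       | no y≢v = inj₂ (y , trans (branch⁻-≢v y≢v) by , inj₁ (e , x≢v , y≢v) , ≤-<-trans (rank⁺≤ y) r)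
    ...       | yes refl with just-injective (trans (sym bv) by)
    ...         | refl = inj₂ (c , trans (branch⁻-≢v c≢v) bc , inj₂ (Link-intro (nbrs x (R-sym e)) c∈ab x≢c)
                             , subst (_< rank x) (sym rank⁺-c) (≤-<-trans z≤n r))

  neitherInSet : ∀ i → branch v ≡ just i → branch a ≢ just i → branch b ≢ just i → ⊥
  neitherInSet i bv a∉ b∉ = othersNotInTwo i otherSets
    where
    notIn : ∀ {x} → OneOf a b x → branch x ≢ just i
    notIn (inj₁ refl) = a∉
    notIn (inj₂ refl) = b∉
    root≡v : root i ≡ v
    root≡v with toRoot v i bv
    ... | inj₁ eq = sym eq
    ... | inj₂ (p , bp , e , _) = ⊥-elim (notIn (nbrs p e) bp)
    onlyV = singletonBranch M v i root≡v (λ x bx e → notIn (nbrs x (R-sym e)) bx)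
    otherSets : ∀ j → i ≢ j → just j ≡ branch a ⊎ just j ≡ branch b
    otherSets j i≢j with touch i j i≢j
    ... | x , y , bx , by , e with onlyV x bx
    ...   | refl with nbrs y e
    ...     | inj₁ refl = inj₁ (sym by)
    ...     | inj₂ refl = inj₂ (sym by)

  model : K4Model R′
  model with branch v in bv
  ... | nothing = whenUnused bv
  ... | just i with ≡-decMaybe _≟_ (branch a) (just i) | ≡-decMaybe _≟_ (branch b) (just i)
  ...   | no a∉ | no b∉ = ⊥-elim (neitherInSet i bv a∉ b∉)
  ...   | yes a∈ | _ with root i ≟ v
  ...     | no root≢v = whenNonRoot i bv root≢v
  ...     | yes root≡v = whenRoot i bv root≡v a (inj₁ refl) a∈
  model | just i | no _ | yes b∈ with root i ≟ v
  ...     | no root≢v = whenNonRoot i bv root≢v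
  ...     | yes root≡v = whenRoot i bv root≡v b (inj₂ refl) b∈

suppress-model : ∀ {n} (R : EdgeRel n) → Symmetric R → ∀ v a b → a ≢ v → b ≢ v →
                 (∀ y → R v y → OneOf a b y) → K4Model R → K4Model (Suppress R v a b)
suppress-model R R-sym v a b a≢v b≢v nbrs M = SuppressModel.model R R-sym v a b a≢v b≢v nbrs M

-- Conversely, if v is adjacent to a and b, a model after suppressing v gives a
-- model of R: v is unused after suppression, it joins the set of a, and the
-- new edge ab is realised by the path a v b.  Ranks are doubled and shifted so
-- that v fits between its parent (a, or b when b precedes a in the same set)
-- and the members whose parent was reached through ab.
module UnsuppressModel {n} (R : EdgeRel n) (R-sym : Symmetric R) (v a b : Fin n)
                       (a≢v : a ≢ v) (b≢v : b ≢ v) (eva : R v a) (evb : R v b)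
                       (M : K4Model (Suppress R v a b)) where
  open K4Model M

  v-unused : branch v ≡ nothing
  v-unused = isolated⇒unused M v noOut noIn
    where
    noOut : ∀ y → ¬ Suppress R v a b v y
    noOut y (inj₁ (_ , v≢v , _)) = v≢v refl
    noOut y (inj₂ (_ , inj₁ (v≡a , _))) = a≢v (sym v≡a)
    noOut y (inj₂ (_ , inj₂ (v≡b , _))) = b≢v (sym v≡b)
    noIn : ∀ y → ¬ Suppress R v a b y v
    noIn y (inj₁ (_ , _ , v≢v)) = v≢v refl
    noIn y (inj₂ (_ , inj₁ (_ , v≡b))) = b≢v (sym v≡b)
    noIn y (inj₂ (_ , inj₂ (_ , v≡a))) = a≢v (sym v≡a)

  member≢v : ∀ {x j} → branch x ≡ just j → x ≢ v
  member≢v bx refl = just≢nothing (trans (sym bx) v-unused)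

  data VParent : Set where
    parentB : branch b ≡ branch a → rank b < rank a → VParent
    parentA : (branch b ≡ branch a → rank b < rank a → ⊥) → VParent

  vParent : VParent
  vParent with ≡-decMaybe _≟_ (branch b) (branch a) | rank b <ℕ? rank a
  ... | yes same | yes b<a = parentB same b<a
  ... | yes _ | no b≮a = parentA (λ _ b<a → b≮a b<a)
  ... | no differ | _ = parentA (λ same _ → differ same)

  vParentVertex : VParent → Fin n
  vParentVertex (parentB _ _) = b
  vParentVertex (parentA _) = a

  shift : ℕ → ℕ
  shift r = suc (suc (double r))

  shift-< : ∀ {p q} → p < q → shift p < shift q
  shift-< r = s≤s (s≤s (≤-trans (n≤1+n _) (double-< r)))

  shift-<′ : ∀ {p q} → p < q → suc (shift p) < shift q
  shift-<′ r = s≤s (s≤s (double-< r))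

  B : Fin n → Maybe (Fin 4)
  B x with x ≟ v
  ... | yes _ = branch a
  ... | no _ = branch x

  Rk : Fin n → ℕ
  Rk x with x ≟ v
  ... | yes _ = suc (shift (rank (vParentVertex vParent)))
  ... | no _ = shift (rank x)

  B-≢v : ∀ {x} → x ≢ v → B x ≡ branch x
  B-≢v {x} x≢v with x ≟ v
  ... | yes x≡v = ⊥-elim (x≢v x≡v)
  ... | no _ = refl

  B-v : B v ≡ branch a
  B-v with v ≟ v
  ... | yes _ = refl
  ... | no v≢v = ⊥-elim (v≢v refl)

  Rk-≢v : ∀ {x} → x ≢ v → Rk x ≡ shift (rank x)
  Rk-≢v {x} x≢v with x ≟ v
  ... | yes x≡v = ⊥-elim (x≢v x≡v)
  ... | no _ = refl

  Rk-v : Rk v ≡ suc (shift (rank (vParentVertex vParent)))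
  Rk-v with v ≟ v
  ... | yes _ = refl
  ... | no v≢v = ⊥-elim (v≢v refl)

  Parent : Fin n → Fin 4 → Set
  Parent x j = Σ (Fin n) λ y → B y ≡ just j × R x y × Rk y < Rk x

  parentOfV : ∀ j p → Rk v ≡ suc (shift (rank (vParentVertex p))) → branch a ≡ just j → Parent v j
  parentOfV j (parentB same _) rv ba =
    b , trans (B-≢v b≢v) (trans same ba) , evb
    , subst₂ _<_ (sym (Rk-≢v b≢v)) (sym rv) (n<1+n _)
  parentOfV j (parentA _) rv ba =
    a , trans (B-≢v a≢v) ba , eva , subst₂ _<_ (sym (Rk-≢v a≢v)) (sym rv) (n<1+n _)

  parentThroughV : ∀ x y j → branch x ≡ just j → branch y ≡ just j → rank y < rank x →
                   (x ≡ a × y ≡ b) ⊎ (x ≡ b × y ≡ a) →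
                   ∀ p → Rk v ≡ suc (shift (rank (vParentVertex p))) → Parent x j
  parentThroughV x y j bx by r (inj₁ (refl , refl)) (parentB _ b<a) rv =
    v , trans B-v bx , R-sym eva , subst₂ _<_ (sym rv) (sym (Rk-≢v a≢v)) (shift-<′ b<a)
  parentThroughV x y j bx by r (inj₁ (refl , refl)) (parentA notB) rv = ⊥-elim (notB (trans by (sym bx)) r)
  parentThroughV x y j bx by r (inj₂ (refl , refl)) (parentB _ b<a) rv = ⊥-elim (<-asym b<a r)
  parentThroughV x y j bx by r (inj₂ (refl , refl)) (parentA _) rv =
    v , trans B-v by , R-sym evb , subst₂ _<_ (sym rv) (sym (Rk-≢v b≢v)) (shift-<′ r)

  toRoot′ : ∀ x j → B x ≡ just j → Dec (x ≡ v) → x ≡ root j ⊎ Parent x j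
  toRoot′ x j bx (yes refl) = inj₂ (parentOfV j vParent Rk-v (trans (sym B-v) bx))
  toRoot′ x j bx (no x≢v) with toRoot x j (trans (sym (B-≢v x≢v)) bx)
  ... | inj₁ r = inj₁ r
  ... | inj₂ (y , by , inj₁ (e , _ , y≢v) , r) =
    inj₂ (y , trans (B-≢v y≢v) by , e , subst₂ _<_ (sym (Rk-≢v y≢v)) (sym (Rk-≢v x≢v)) (shift-< r))
  ... | inj₂ (y , by , inj₂ (_ , ends) , r) =
    inj₂ (parentThroughV x y j (trans (sym (B-≢v x≢v)) bx) by r ends vParent Rk-v)

  touch′ : ∀ j k → j ≢ k → Σ (Fin n) λ x → Σ (Fin n) λ y → B x ≡ just j × B y ≡ just k × R x y
  touch′ j k j≢k with touch j k j≢k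
  ... | x , y , bx , by , inj₁ (e , x≢v , y≢v) = x , y , trans (B-≢v x≢v) bx , trans (B-≢v y≢v) by , e
  ... | x , y , bx , by , inj₂ (_ , inj₁ (refl , refl)) = v , y , trans B-v bx , trans (B-≢v b≢v) by , evb
  ... | x , y , bx , by , inj₂ (_ , inj₂ (refl , refl)) = x , v , trans (B-≢v b≢v) bx , trans B-v by , R-sym evb

  model : K4Model R
  model = record { branch = B ; root = root ; root∈ = λ j → trans (B-≢v (member≢v (root∈ j))) (root∈ j)
                 ; rank = Rk ; toRoot = λ x j bx → toRoot′ x j bx (x ≟ v) ; touch = touch′ }

unsuppress-model : ∀ {n} (R : EdgeRel n) → Symmetric R → ∀ v a b → a ≢ v → b ≢ v → R v a → R v b →
                   K4Model (Suppress R v a b) → K4Model R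
unsuppress-model R R-sym v a b a≢v b≢v eva evb M = UnsuppressModel.model R R-sym v a b a≢v b≢v eva evb M

bit : Bool → ℕ
bit true = 1
bit false = 0

size : ∀ {n} → (Fin n → Bool) → ℕ
size {zero} _ = 0
size {suc n} p = bit (p zero) + size (λ x → p (suc x))

_⊆ᵇ_ : ∀ {n} → (Fin n → Bool) → (Fin n → Bool) → Set
p ⊆ᵇ q = ∀ x → p x ≡ true → q x ≡ true

bit-mono : ∀ {a b} → (a ≡ true → b ≡ true) → bit a ≤ bit b
bit-mono {false} _ = z≤n
bit-mono {true} a⇒b with a⇒b refl
... | refl = ≤-refl

size-mono : ∀ {n} (p q : Fin n → Bool) → p ⊆ᵇ q → size p ≤ size q
size-mono {zero} p q p⊆q = z≤n
size-mono {suc n} p q p⊆q = +-mono-≤ (bit-mono (p⊆q zero)) (size-mono _ _ (λ x → p⊆q (suc x)))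

size-strict : ∀ {n} (p q : Fin n → Bool) → p ⊆ᵇ q → ∀ x → q x ≡ true → p x ≡ false → size p < size q
size-strict {suc n} p q p⊆q zero qx px rewrite qx | px = s≤s (size-mono _ _ (λ x → p⊆q (suc x)))
size-strict {suc n} p q p⊆q (suc x) qx px =
  ≤-<-trans (+-monoˡ-≤ (size (λ y → p (suc y))) (bit-mono (p⊆q zero)))
            (+-monoʳ-< (bit (q zero)) (size-strict _ _ (λ y → p⊆q (suc y)) x qx px))

size-≤ : ∀ {n} (p : Fin n → Bool) → size p ≤ n
size-≤ {zero} p = z≤n
size-≤ {suc n} p with p zero
... | true = s≤s (size-≤ _)
... | false = m≤n⇒m≤1+n (size-≤ _)

injective-bound : ∀ {n} (k : ℕ) (p : ℕ → Fin n) →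
                  (∀ m m′ → m ≤ k → m′ ≤ k → p m ≡ p m′ → m ≡ m′) → k < n
injective-bound {n} k p inj with suc k ≤?ℕ n
... | yes k<n = k<n
... | no k≮n with pigeonhole (≰⇒> k≮n) (λ (i : Fin (suc k)) → p (toℕ i))
...   | i , j , i<j , eq =
  ⊥-elim (<⇒≢ i<j (inj (toℕ i) (toℕ j) (≤-pred (toℕ<n i)) (≤-pred (toℕ<n j)) eq))

-- Growing the component of w in R − Ex: a set Y ∋ w avoiding Ex, connected
-- towards w (every other member has a neighbour in Y of smaller distance
-- label), and on which a property Inv holds that propagates along edges to
-- vertices outside Ex.
record Component {n} (R : EdgeRel n) (Ex Inv : Fin n → Set) (w : Fin n) : Set where
  field
    inY    : Fin n → Bool
    dist   : Fin n → ℕ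
    w∈Y    : inY w ≡ true
    toW    : ∀ y → inY y ≡ true → y ≡ w ⊎ Σ (Fin n) λ z → inY z ≡ true × R y z × dist z < dist y
    avoids : ∀ y → inY y ≡ true → ¬ Ex y
    inv    : ∀ y → inY y ≡ true → Inv y

ClosedComponent : ∀ {n} {R : EdgeRel n} {Ex Inv w} → Component R Ex Inv w → Set
ClosedComponent {n} {R} {Ex} C = ∀ y z → Component.inY C y ≡ true → R y z → Component.inY C z ≡ true ⊎ Ex z

module ComponentGrowth {n} (R : EdgeRel n) (R-sym : Symmetric R) (R? : ∀ x y → Dec (R x y))
                       (Ex : Fin n → Set) (Ex? : ∀ x → Dec (Ex x)) (Inv : Fin n → Set)
                       (inv-step : ∀ y z → Inv y → R y z → ¬ Ex z → Inv z)
                       (w : Fin n) (w∉Ex : ¬ Ex w) (inv-w : Inv w) where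
  open Component

  singleton : Component R Ex Inv w
  singleton = record
    { inY = λ y → y == w ; dist = λ _ → 0 ; w∈Y = ==-refl w ; toW = λ y y∈ → inj₁ (==⇒≡ y∈)
    ; avoids = λ y y∈ → subst (λ q → ¬ Ex q) (sym (==⇒≡ y∈)) w∉Ex
    ; inv = λ y y∈ → subst Inv (sym (==⇒≡ y∈)) inv-w }

  Frontier : Component R Ex Inv w → Fin n → Set
  Frontier C z = inY C z ≡ false × ¬ Ex z × Σ (Fin n) λ y → inY C y ≡ true × R y z

  frontier? : ∀ C z → Dec (Frontier C z)
  frontier? C z = (inY C z ≟B false) ×-dec (¬? (Ex? z) ×-dec any? (λ y → (inY C y ≟B true) ×-dec R? y z))

  addFrontier : ∀ C z → Frontier C z → Σ (Component R Ex Inv w) λ C′ → size (inY C) < size (inY C′)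
  addFrontier C z (z∉C , z∉Ex , y , y∈C , eyz) =
    C′ , size-strict (inY C) inY′ (λ q q∈ → ∨-introˡ q∈) z (∨-introʳ (==-refl z)) z∉C
    where
    inY′ : Fin n → Bool
    inY′ q = inY C q ∨ (q == z)
    inY′-cases : ∀ {q} → inY′ q ≡ true → inY C q ≡ true ⊎ q ≡ z
    inY′-cases q∈ with ∨-true q∈
    ... | inj₁ old = inj₁ old
    ... | inj₂ new = inj₂ (==⇒≡ new)
    member≢z : ∀ {q} → inY C q ≡ true → q ≢ z
    member≢z q∈ refl = true≢false q∈ z∉C
    dist′ : Fin n → ℕ
    dist′ q with q ≟ z
    ... | yes _ = suc (dist C y)
    ... | no _ = dist C q
    dist′-old : ∀ {q} → q ≢ z → dist′ q ≡ dist C q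
    dist′-old {q} q≢z with q ≟ z
    ... | yes q≡z = ⊥-elim (q≢z q≡z)
    ... | no _ = refl
    dist′-z : dist′ z ≡ suc (dist C y)
    dist′-z with z ≟ z
    ... | yes _ = refl
    ... | no z≢z = ⊥-elim (z≢z refl)
    toW′ : ∀ q → inY′ q ≡ true → q ≡ w ⊎ Σ (Fin n) λ r → inY′ r ≡ true × R q r × dist′ r < dist′ q
    toW′ q q∈ with inY′-cases q∈
    ... | inj₂ refl = inj₂ (y , ∨-introˡ y∈C , R-sym eyz
                           , subst₂ _<_ (sym (dist′-old (member≢z y∈C))) (sym dist′-z) (n<1+n _))
    ... | inj₁ q∈C with toW C q q∈C
    ...   | inj₁ q≡w = inj₁ q≡w
    ...   | inj₂ (r , r∈C , e , lt) =
      inj₂ (r , ∨-introˡ r∈C , e , subst₂ _<_ (sym (dist′-old (member≢z r∈C))) (sym (dist′-old (member≢z q∈C))) lt)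
    avoids′ : ∀ q → inY′ q ≡ true → ¬ Ex q
    avoids′ q q∈ with inY′-cases q∈
    ... | inj₁ q∈C = avoids C q q∈C
    ... | inj₂ refl = z∉Ex
    inv′ : ∀ q → inY′ q ≡ true → Inv q
    inv′ q q∈ with inY′-cases q∈
    ... | inj₁ q∈C = inv C q q∈C
    ... | inj₂ refl = inv-step y z (inv C y y∈C) eyz z∉Ex
    C′ : Component R Ex Inv w
    C′ = record { inY = inY′ ; dist = dist′ ; w∈Y = ∨-introˡ (w∈Y C) ; toW = toW′ ; avoids = avoids′ ; inv = inv′ }

  -- Add frontier vertices until there are none; sizes are bounded by n.
  grow : ∀ fuel (C : Component R Ex Inv w) → n ≤ size (inY C) + fuel → Σ (Component R Ex Inv w) ClosedComponent
  grow fuel C bound with any? (frontier? C)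
  ... | no noFrontier = C , closed
    where
    closed : ClosedComponent C
    closed y z y∈C eyz with inY C z in z∈?
    ... | true = inj₁ refl
    ... | false with Ex? z
    ...   | yes z∈Ex = inj₂ z∈Ex
    ...   | no z∉Ex = ⊥-elim (noFrontier (z , z∈? , z∉Ex , y , y∈C , eyz))
  ... | yes (z , fz) with addFrontier C z fz | fuel
  ...   | C′ , bigger | zero =
    ⊥-elim (<-irrefl refl (<-≤-trans (≤-<-trans (subst (n ≤_) (+-identityʳ _) bound) bigger) (size-≤ (inY C′))))
  ...   | C′ , bigger | suc fuel′ = grow fuel′ C′ (≤-trans (subst (n ≤_) (+-suc _ fuel′) bound) (+-monoˡ-≤ fuel′ bigger))

  closedComponent : Σ (Component R Ex Inv w) ClosedComponent
  closedComponent = grow n singleton (subst (n ≤_) (+-comm n _) (m≤m+n n _))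

orderedPair : ∀ (P : ℕ → Set) a b → a ≢ b → P a → P b → Σ ℕ λ i → Σ ℕ λ j → i < j × P i × P j
orderedPair P a b a≢b pa pb with <-cmp a b
... | tri< a<b _ _ = a , b , a<b , pa , pb
... | tri≈ _ a≡b _ = ⊥-elim (a≢b a≡b)
... | tri> _ _ b<a = b , a , b<a , pb , pa

onlyOneLast : ∀ {a b k} → suc a ≡ k → a ≢ b → suc b ≢ k
onlyOneLast last a≢b e = a≢b (cong pred (trans last (sym e)))

twoBeforeLast : ∀ (k : ℕ) (Q : ℕ → Set) m₁ m₂ m₃ → m₁ < k → m₂ < k → m₃ < k →
                m₁ ≢ m₂ → m₁ ≢ m₃ → m₂ ≢ m₃ → Q m₁ → Q m₂ → Q m₃ →
                Σ ℕ λ i → Σ ℕ λ j → i < j × (suc i < k × Q i) × (suc j < k × Q j)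
twoBeforeLast k Q m₁ m₂ m₃ h₁ h₂ h₃ n₁₂ n₁₃ n₂₃ q₁ q₂ q₃ with suc m₁ ≟ℕ k | suc m₂ ≟ℕ k
... | yes last₁ | _ =
  orderedPair _ m₂ m₃ n₂₃ (≤∧≢⇒< h₂ (onlyOneLast last₁ n₁₂) , q₂) (≤∧≢⇒< h₃ (onlyOneLast last₁ n₁₃) , q₃)
... | no notLast₁ | yes last₂ =
  orderedPair _ m₁ m₃ n₁₃ (≤∧≢⇒< h₁ notLast₁ , q₁) (≤∧≢⇒< h₃ (onlyOneLast last₂ n₂₃) , q₃)
... | no notLast₁ | no notLast₂ =
  orderedPair _ m₁ m₂ n₁₂ (≤∧≢⇒< h₁ notLast₁ , q₁) (≤∧≢⇒< h₂ notLast₂ , q₂)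

-- Dirac's theorem: three distinct neighbours at every vertex force a K₄-model.
-- It is proved in a relative form, by induction on the size of S.
module Dirac {n} (R : EdgeRel n) (R-sym : Symmetric R) (R-irrefl : Irreflexive R)
             (R? : ∀ x y → Dec (R x y)) where

  ThreeNeighbours : Fin n → Set
  ThreeNeighbours x = Σ (Fin n) λ a → Σ (Fin n) λ b → Σ (Fin n) λ c →
                      a ≢ b × a ≢ c × b ≢ c × R x a × R x b × R x c

  Inner : (Fin n → Bool) → Fin n → Fin n → Fin n → Set
  Inner S s t x = S x ≡ true × x ≢ s × x ≢ t

  record Instance (S : Fin n → Bool) (s t : Fin n) : Set where
    field
      s∈S : S s ≡ true
      t∈S : S t ≡ true
      s≢t : s ≢ t
      est : R s t
      closed : ∀ x → Inner S s t x → ∀ y → R x y → S y ≡ true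
      three : ∀ x → Inner S s t x → ThreeNeighbours x
      someInner : Σ (Fin n) (Inner S s t)

  swapInstance : ∀ {S s t} → Instance S s t → Instance S t s
  swapInstance I = record
    { s∈S = t∈S ; t∈S = s∈S ; s≢t = λ e → s≢t (sym e) ; est = R-sym est
    ; closed = λ x (x∈S , x≢s , x≢t) → closed x (x∈S , x≢t , x≢s)
    ; three = λ x (x∈S , x≢s , x≢t) → three x (x∈S , x≢t , x≢s)
    ; someInner = let (x , x∈S , x≢s , x≢t) = someInner in x , x∈S , x≢t , x≢s }
    where open Instance I

  -- A maximal path s t x₀ …
  -- ends at v whose neighbours all lie on the path; two of them, at i < j,
  -- come before the predecessor of v.  Let a′ = at j and w = at (j + 1), and
  -- let Y be the component of w after removing the prefix before j, a′ and v.
  -- Either Y touches the prefix, giving the model {v}, {a′}, prefix, Y, or Y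
  -- together with a′ and v forms a smaller instance with edge a′v.
  module PathArgument (S : Fin n → Bool) (s t : Fin n) (I : Instance S s t)
                      (IH : ∀ S′ s′ t′ → size S′ < size S → Instance S′ s′ t′ → K4Model R)
                      (x₀ : Fin n) (x₀-inner : Inner S s t x₀) (etx₀ : R t x₀) where
    open Instance I

    record Path : Set where
      field
        len : ℕ
        at : ℕ → Fin n
        len≥2 : 2 ≤ len
        at0 : at 0 ≡ s
        at1 : at 1 ≡ t
        step : ∀ m → m < len → R (at m) (at (suc m))
        injective : ∀ m m′ → m ≤ len → m′ ≤ len → at m ≡ at m′ → m ≡ m′
        inner : ∀ m → 2 ≤ m → m ≤ len → Inner S s t (at m)

    OnPath : Path → Fin n → Set
    OnPath P y = Σ ℕ λ m → m < suc (Path.len P) × Path.at P m ≡ y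

    onPath? : ∀ P y → Dec (OnPath P y)
    onPath? P y = anyUpTo? (λ m → Path.at P m ≟ y) (suc (Path.len P))

    initialPath : Path
    initialPath = record { len = 2 ; at = at ; len≥2 = ≤-refl ; at0 = refl ; at1 = refl
                         ; step = step ; injective = injective ; inner = inner }
      where
      x₀≢s = proj₁ (proj₂ x₀-inner)
      x₀≢t = proj₂ (proj₂ x₀-inner)
      at : ℕ → Fin n
      at 0 = s
      at 1 = t
      at _ = x₀
      step : ∀ m → m < 2 → R (at m) (at (suc m))
      step 0 _ = est
      step 1 _ = etx₀
      step (suc (suc _)) (s≤s (s≤s ()))
      injective : ∀ m m′ → m ≤ 2 → m′ ≤ 2 → at m ≡ at m′ → m ≡ m′
      injective 0 0 _ _ _ = refl
      injective 0 1 _ _ e = ⊥-elim (s≢t e)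
      injective 0 2 _ _ e = ⊥-elim (x₀≢s (sym e))
      injective 1 0 _ _ e = ⊥-elim (s≢t (sym e))
      injective 1 1 _ _ _ = refl
      injective 1 2 _ _ e = ⊥-elim (x₀≢t (sym e))
      injective 2 0 _ _ e = ⊥-elim (x₀≢s e)
      injective 2 1 _ _ e = ⊥-elim (x₀≢t e)
      injective 2 2 _ _ _ = refl
      injective (suc (suc (suc _))) _ (s≤s (s≤s ())) _ _
      injective 0 (suc (suc (suc _))) _ (s≤s (s≤s ())) _
      injective 1 (suc (suc (suc _))) _ (s≤s (s≤s ())) _
      injective 2 (suc (suc (suc _))) _ (s≤s (s≤s ())) _
      inner : ∀ m → 2 ≤ m → m ≤ 2 → Inner S s t (at m)
      inner 0 () _
      inner 1 (s≤s ()) _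
      inner 2 _ _ = x₀-inner
      inner (suc (suc (suc _))) _ (s≤s (s≤s ()))

    -- Appending a neighbour y of the end that is not on the path; y is inner
    -- because the end is, and s, t are on the path.
    extend : (P : Path) → ∀ y → R (Path.at P (Path.len P)) y → ¬ OnPath P y → Path
    extend P y e y∉P = record
      { len = suc len ; at = at′ ; len≥2 = m≤n⇒m≤1+n len≥2
      ; at0 = trans (at′-old z≤n) at0 ; at1 = trans (at′-old (≤-trans (s≤s z≤n) len≥2)) at1
      ; step = step′ ; injective = injective′ ; inner = inner′ }
      where
      open Path P
      at′ : ℕ → Fin n
      at′ m with m ≟ℕ suc len
      ... | yes _ = y
      ... | no _ = at m
      at′-old : ∀ {m} → m ≤ len → at′ m ≡ at m
      at′-old {m} m≤len with m ≟ℕ suc len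
      ... | yes refl = ⊥-elim (<-irrefl refl m≤len)
      ... | no _ = refl
      at′-new : at′ (suc len) ≡ y
      at′-new with suc len ≟ℕ suc len
      ... | yes _ = refl
      ... | no ≢ = ⊥-elim (≢ refl)
      old : ∀ {m} → m ≤ suc len → m ≢ suc len → m ≤ len
      old m≤ m≢ = ≤-pred (≤∧≢⇒< m≤ m≢)
      y-new : ∀ {m} → m ≤ len → at′ m ≢ y
      y-new m≤len eq = y∉P (_ , s≤s m≤len , trans (sym (at′-old m≤len)) eq)
      step′ : ∀ m → m < suc len → R (at′ m) (at′ (suc m))
      step′ m m<len′ with m ≟ℕ len
      ... | yes refl = subst₂ R (sym (at′-old ≤-refl)) (sym at′-new) e
      ... | no m≢len = subst₂ R (sym (at′-old (<⇒≤ m<len))) (sym (at′-old m<len)) (step m m<len)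
        where m<len = ≤∧≢⇒< (≤-pred m<len′) m≢len
      injective′ : ∀ m m′ → m ≤ suc len → m′ ≤ suc len → at′ m ≡ at′ m′ → m ≡ m′
      injective′ m m′ h h′ eq = byCases m m′ h h′ eq (m ≟ℕ suc len) (m′ ≟ℕ suc len)
        where
        byCases : ∀ m m′ → m ≤ suc len → m′ ≤ suc len → at′ m ≡ at′ m′ →
                  Dec (m ≡ suc len) → Dec (m′ ≡ suc len) → m ≡ m′
        byCases _ _ _ _ _ (yes refl) (yes refl) = refl
        byCases _ m′ _ h′ eq (yes refl) (no m′≢) = ⊥-elim (y-new (old h′ m′≢) (trans (sym eq) at′-new))
        byCases m _ h _ eq (no m≢) (yes refl) = ⊥-elim (y-new (old h m≢) (trans eq at′-new))
        byCases m m′ h h′ eq (no m≢) (no m′≢) =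
          injective m m′ (old h m≢) (old h′ m′≢) (trans (sym (at′-old (old h m≢))) (trans eq (at′-old (old h′ m′≢))))
      inner′ : ∀ m → 2 ≤ m → m ≤ suc len → Inner S s t (at′ m)
      inner′ m 2≤m h = byCases m 2≤m h (m ≟ℕ suc len)
        where
        byCases : ∀ m → 2 ≤ m → m ≤ suc len → Dec (m ≡ suc len) → Inner S s t (at′ m)
        byCases m 2≤m h (no m≢) = subst (Inner S s t) (sym (at′-old (old h m≢))) (inner m 2≤m (old h m≢))
        byCases _ _ _ (yes refl) = subst (Inner S s t) (sym at′-new)
          ( closed (at len) (inner len len≥2 ≤-refl) y e
          , (λ eq → y∉P (0 , s≤s z≤n , trans at0 (sym eq)))
          , (λ eq → y∉P (1 , s≤s (≤-trans (s≤s z≤n) len≥2) , trans at1 (sym eq))))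

    Maximal : Path → Set
    Maximal P = ∀ y → R (Path.at P (Path.len P)) y → OnPath P y

    -- Extend until the end has no neighbour off the path; paths are shorter than n.
    maximalPath : ∀ fuel (P : Path) → n ≤ Path.len P + fuel → Σ Path Maximal
    maximalPath fuel P bound with any? (λ y → R? (Path.at P (Path.len P)) y ×-dec ¬? (onPath? P y))
    ... | no noExit = P , λ y e → decidable-stable (onPath? P y) (λ y∉P → noExit (y , e , y∉P))
    ... | yes (y , e , y∉P) with fuel
    ...   | zero = ⊥-elim (<-irrefl refl (<-≤-trans (injective-bound (Path.len P) (Path.at P) (Path.injective P))
                                                   (subst (n ≤_) (+-identityʳ _) bound)))
    ...   | suc fuel′ = maximalPath fuel′ (extend P y e y∉P) (subst (n ≤_) (+-suc (Path.len P) fuel′) bound)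

    -- The end v of a maximal path has all its neighbours on the path, hence two
    -- at positions i < j with j + 1 < len.
    module AtEnd (P : Path) (maximal : Maximal P) where
      open Path P
      v = at len

      positionOf : ∀ y → R v y → Σ ℕ λ m → m < len × at m ≡ y
      positionOf y e with maximal y e
      ... | m , s≤s m≤len , eq = m , ≤∧≢⇒< m≤len (λ m≡len → R-irrefl e (trans (cong at (sym m≡len)) eq)) , eq

      chords : Σ ℕ λ i → Σ ℕ λ j → i < j × (suc i < len × R v (at i)) × (suc j < len × R v (at j))
      chords with three v (inner len len≥2 ≤-refl)
      ... | a₁ , a₂ , a₃ , n₁₂ , n₁₃ , n₂₃ , e₁ , e₂ , e₃
        with positionOf a₁ e₁ | positionOf a₂ e₂ | positionOf a₃ e₃
      ...   | m₁ , h₁ , q₁ | m₂ , h₂ , q₂ | m₃ , h₃ , q₃ =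
        twoBeforeLast len (λ m → R v (at m)) m₁ m₂ m₃ h₁ h₂ h₃
          (λ eq → n₁₂ (trans (sym q₁) (trans (cong at eq) q₂)))
          (λ eq → n₁₃ (trans (sym q₁) (trans (cong at eq) q₃)))
          (λ eq → n₂₃ (trans (sym q₂) (trans (cong at eq) q₃)))
          (subst (R v) (sym q₁) e₁) (subst (R v) (sym q₂) e₂) (subst (R v) (sym q₃) e₃)

      module Split (i j₀ : ℕ) (i<j : i < suc j₀) (j+1<len : suc (suc j₀) < len)
                   (evi : R v (at i)) (evj : R v (at (suc j₀))) where
        j = suc j₀
        a′ = at j
        w = at (suc j)

        j<len : j < len
        j<len = <-trans (n<1+n j) j+1<len

        inj : ∀ {m m′} → m ≤ len → m′ ≤ len → at m ≡ at m′ → m ≡ m′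
        inj = injective _ _

        Prefix : Fin n → Set
        Prefix y = Σ ℕ λ m → m < j × at m ≡ y

        prefix? : ∀ y → Dec (Prefix y)
        prefix? y = anyUpTo? (λ m → at m ≟ y) j

        Excluded : Fin n → Set
        Excluded y = Prefix y ⊎ y ≡ a′ ⊎ y ≡ v

        excluded? : ∀ y → Dec (Excluded y)
        excluded? y = prefix? y ⊎-dec (y ≟ a′ ⊎-dec y ≟ v)

        prefix≢v : ∀ {y} → Prefix y → y ≢ v
        prefix≢v (m , m<j , refl) e = <-irrefl (inj (<⇒≤ (<-trans m<j j<len)) ≤-refl e) (<-trans m<j j<len)

        prefix≢a′ : ∀ {y} → Prefix y → y ≢ a′
        prefix≢a′ (m , m<j , refl) e = <-irrefl (inj (<⇒≤ (<-trans m<j j<len)) (<⇒≤ j<len) e) m<j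

        tail∉Excluded : ∀ m → j < m → m < len → ¬ Excluded (at m)
        tail∉Excluded m j<m m<len (inj₁ (m′ , m′<j , eq)) =
          <-irrefl (inj (<⇒≤ (<-trans m′<j j<len)) (<⇒≤ m<len) eq) (<-trans m′<j j<m)
        tail∉Excluded m j<m m<len (inj₂ (inj₁ eq)) = <-irrefl (sym (inj (<⇒≤ m<len) (<⇒≤ j<len) eq)) j<m
        tail∉Excluded m j<m m<len (inj₂ (inj₂ eq)) = <-irrefl (inj (<⇒≤ m<len) ≤-refl eq) m<len

        s-excluded : Excluded s
        s-excluded = inj₁ (0 , s≤s z≤n , at0)

        t-excluded : Excluded t
        t-excluded with j₀ ≟ℕ 0
        ... | yes j₀≡0 = inj₂ (inj₁ (trans (sym at1) (cong (λ q → at (suc q)) (sym j₀≡0))))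
        ... | no j₀≢0 = inj₁ (1 , s≤s (≤∧≢⇒< z≤n (λ e → j₀≢0 (sym e))) , at1)

        a′≢v : a′ ≢ v
        a′≢v e = <-irrefl (inj (<⇒≤ j<len) ≤-refl e) j<len

        s≢a′ : s ≢ a′
        s≢a′ e with inj z≤n (<⇒≤ j<len) (trans at0 e)
        ... | ()

        s≢v : s ≢ v
        s≢v e = <-irrefl (inj z≤n ≤-refl (trans at0 e)) (<-trans (s≤s z≤n) j<len)

        path⊆S : ∀ m → m ≤ len → S (at m) ≡ true
        path⊆S 0 _ = subst (λ q → S q ≡ true) (sym at0) s∈S
        path⊆S 1 _ = subst (λ q → S q ≡ true) (sym at1) t∈S
        path⊆S (suc (suc m)) h = proj₁ (inner (suc (suc m)) (s≤s (s≤s z≤n)) h)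

        w-inner : Inner S s t w
        w-inner = inner (suc j) (s≤s (s≤s z≤n)) (<⇒≤ j+1<len)

        inner-step : ∀ y z → Inner S s t y → R y z → ¬ Excluded z → Inner S s t z
        inner-step y z y-inner eyz z∉ =
          closed y y-inner z eyz , (λ e → z∉ (subst Excluded (sym e) s-excluded))
                                 , (λ e → z∉ (subst Excluded (sym e) t-excluded))

        open ComponentGrowth R R-sym R? Excluded excluded? (Inner S s t) inner-step
                             w (tail∉Excluded (suc j) ≤-refl j+1<len) w-inner
          using (closedComponent)

        Crossing : Component R Excluded (Inner S s t) w → Set
        Crossing C = Σ (Fin n) λ y → Component.inY C y ≡ true × Σ (Fin n) λ z → Prefix z × R y z

        crossing? : ∀ C → Dec (Crossing C)
        crossing? C = any? (λ y → (Component.inY C y ≟B true) ×-dec any? (λ z → prefix? z ×-dec R? y z))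

        module WithComponent (C : Component R Excluded (Inner S s t) w) (closedC : ClosedComponent C) where
          open Component C

          tail∈Y : ∀ m → j < m → m < len → inY (at m) ≡ true
          tail∈Y zero () _
          tail∈Y (suc m) j<m+1 m+1<len with suc j ≟ℕ suc m
          ... | yes eq = subst (λ q → inY (at q) ≡ true) eq w∈Y
          ... | no ≢ with closedC (at m) (at (suc m)) (tail∈Y m (≤-pred (≤∧≢⇒< j<m+1 ≢)) (<-trans (n<1+n m) m+1<len))
                                  (step m (<⇒≤ m+1<len))
          ...   | inj₁ y∈Y = y∈Y
          ...   | inj₂ excl = ⊥-elim (tail∉Excluded (suc m) j<m+1 m+1<len excl)

          -- The branch sets {v}, {a′}, the prefix (root s, ranked by position)
          -- and Y (root w, ranked by distance).
          classify : ∀ {A B D : Set} → Dec A → Dec B → Dec D → Bool → Maybe (Fin 4)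
          classify (yes _) _ _ _ = just zero
          classify (no _) (yes _) _ _ = just (suc zero)
          classify (no _) (no _) (yes _) _ = just (suc (suc zero))
          classify (no _) (no _) (no _) true = just (suc (suc (suc zero)))
          classify (no _) (no _) (no _) false = nothing

          setOf : Fin n → Maybe (Fin 4)
          setOf q = classify (q ≟ v) (q ≟ a′) (prefix? q) (inY q)

          rankBy : ∀ q → Dec (Prefix q) → ℕ
          rankBy q (yes (m , _)) = m
          rankBy q (no _) = dist q

          rankOf : Fin n → ℕ
          rankOf q = rankBy q (prefix? q)

          rootOf : Fin 4 → Fin n
          rootOf zero = v
          rootOf (suc zero) = a′
          rootOf (suc (suc zero)) = s
          rootOf (suc (suc (suc zero))) = w

          setOf-v : setOf v ≡ just zero
          setOf-v with v ≟ v
          ... | yes _ = refl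
          ... | no v≢v = ⊥-elim (v≢v refl)

          setOf-a′ : setOf a′ ≡ just (suc zero)
          setOf-a′ with a′ ≟ v | a′ ≟ a′
          ... | yes e | _ = ⊥-elim (a′≢v e)
          ... | no _ | yes _ = refl
          ... | no _ | no a′≢a′ = ⊥-elim (a′≢a′ refl)

          setOf-prefix : ∀ {q} → Prefix q → setOf q ≡ just (suc (suc zero))
          setOf-prefix {q} pq with q ≟ v | q ≟ a′ | prefix? q
          ... | yes e | _ | _ = ⊥-elim (prefix≢v pq e)
          ... | no _ | yes e | _ = ⊥-elim (prefix≢a′ pq e)
          ... | no _ | no _ | yes _ = refl
          ... | no _ | no _ | no ¬pq = ⊥-elim (¬pq pq)

          setOf-Y : ∀ {q} → inY q ≡ true → setOf q ≡ just (suc (suc (suc zero)))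
          setOf-Y {q} q∈Y with q ≟ v | q ≟ a′ | prefix? q | inY q | q∈Y
          ... | yes e | _ | _ | _ | _ = ⊥-elim (avoids q q∈Y (inj₂ (inj₂ e)))
          ... | no _ | yes e | _ | _ | _ = ⊥-elim (avoids q q∈Y (inj₂ (inj₁ e)))
          ... | no _ | no _ | yes pq | _ | _ = ⊥-elim (avoids q q∈Y (inj₁ pq))
          ... | no _ | no _ | no _ | true | _ = refl

          rankOf-prefix : ∀ m → m < j → rankOf (at m) ≡ m
          rankOf-prefix m m<j with prefix? (at m)
          ... | yes (m′ , m′<j , eq) = inj (<⇒≤ (<-trans m′<j j<len)) (<⇒≤ (<-trans m<j j<len)) eq
          ... | no ¬p = ⊥-elim (¬p (m , m<j , refl))

          rankOf-Y : ∀ {q} → inY q ≡ true → rankOf q ≡ dist q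
          rankOf-Y {q} q∈Y with prefix? q
          ... | yes pq = ⊥-elim (avoids q q∈Y (inj₁ pq))
          ... | no _ = refl

          ToRoot : Fin n → Fin 4 → Set
          ToRoot q k = q ≡ rootOf k ⊎ Σ (Fin n) λ y → setOf y ≡ just k × R q y × rankOf y < rankOf q

          -- Prefix vertices step back along the path, Y vertices towards w.
          toRootBy : ∀ q k (d₁ : Dec (q ≡ v)) (d₂ : Dec (q ≡ a′)) (d₃ : Dec (Prefix q)) b →
                     inY q ≡ b → classify d₁ d₂ d₃ b ≡ just k → ToRoot q k
          toRootBy q k (yes refl) _ _ _ _ refl = inj₁ refl
          toRootBy q k (no _) (yes refl) _ _ _ refl = inj₁ refl
          toRootBy q k (no _) (no _) (yes (zero , _ , eq)) _ _ refl = inj₁ (trans (sym eq) at0)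
          toRootBy q k (no _) (no _) (yes (suc m , m+1<j , refl)) _ _ refl =
            inj₂ (at m , setOf-prefix (m , <-trans (n<1+n m) m+1<j , refl)
                 , R-sym (step m (<⇒≤ (<-trans m+1<j j<len)))
                 , subst₂ _<_ (sym (rankOf-prefix m (<-trans (n<1+n m) m+1<j))) (sym (rankOf-prefix (suc m) m+1<j)) (n<1+n m))
          toRootBy q k (no _) (no _) (no _) true q∈Y refl with toW q q∈Y
          ... | inj₁ q≡w = inj₁ q≡w
          ... | inj₂ (z , z∈Y , e , lt) =
            inj₂ (z , setOf-Y z∈Y , e , subst₂ _<_ (sym (rankOf-Y z∈Y)) (sym (rankOf-Y q∈Y)) lt)
          toRootBy q k (no _) (no _) (no _) false _ ()

          ℓ = pred len
          suc-ℓ : suc ℓ ≡ len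
          suc-ℓ with len | len≥2
          ... | suc _ | _ = refl
          ℓ<len : ℓ < len
          ℓ<len = subst (_≤ len) (sym suc-ℓ) ≤-refl
          last∈Y : inY (at ℓ) ≡ true
          last∈Y = tail∈Y ℓ (≤-pred (subst (suc (suc j) ≤_) (sym suc-ℓ) j+1<len)) ℓ<len
          ev-last : R v (at ℓ)
          ev-last = R-sym (subst (λ q → R (at ℓ) (at q)) suc-ℓ (step ℓ ℓ<len))

          Touches : Fin 4 → Fin 4 → Set
          Touches k k′ = Σ (Fin n) λ x → Σ (Fin n) λ y → setOf x ≡ just k × setOf y ≡ just k′ × R x y

          flipTouch : ∀ {k k′} → Touches k k′ → Touches k′ k
          flipTouch (x , y , bx , by , e) = y , x , by , bx , R-sym e

          crossModel : ∀ y₁ z₁ → inY y₁ ≡ true → Prefix z₁ → R y₁ z₁ → K4Model R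
          crossModel y₁ z₁ y₁∈Y z₁∈P e₁ = record
            { branch = setOf ; root = rootOf
            ; root∈ = λ { zero → setOf-v ; (suc zero) → setOf-a′
                        ; (suc (suc zero)) → setOf-prefix (0 , s≤s z≤n , at0)
                        ; (suc (suc (suc zero))) → setOf-Y w∈Y }
            ; rank = rankOf
            ; toRoot = λ q k sq → toRootBy q k (q ≟ v) (q ≟ a′) (prefix? q) (inY q) refl sq
            ; touch = touch }
            where
            t01 : Touches zero (suc zero)
            t01 = v , a′ , setOf-v , setOf-a′ , evj
            t02 : Touches zero (suc (suc zero))
            t02 = v , at i , setOf-v , setOf-prefix (i , i<j , refl) , evi
            t03 : Touches zero (suc (suc (suc zero)))
            t03 = v , at ℓ , setOf-v , setOf-Y last∈Y , ev-last
            t12 : Touches (suc zero) (suc (suc zero))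
            t12 = a′ , at j₀ , setOf-a′ , setOf-prefix (j₀ , n<1+n j₀ , refl) , R-sym (step j₀ (<⇒≤ j<len))
            t13 : Touches (suc zero) (suc (suc (suc zero)))
            t13 = a′ , w , setOf-a′ , setOf-Y w∈Y , step j j<len
            t23 : Touches (suc (suc zero)) (suc (suc (suc zero)))
            t23 = z₁ , y₁ , setOf-prefix z₁∈P , setOf-Y y₁∈Y , R-sym e₁
            touch : ∀ k k′ → k ≢ k′ → Touches k k′
            touch zero zero k≢k = ⊥-elim (k≢k refl)
            touch zero (suc zero) _ = t01
            touch zero (suc (suc zero)) _ = t02
            touch zero (suc (suc (suc zero))) _ = t03
            touch (suc zero) zero _ = flipTouch t01
            touch (suc zero) (suc zero) k≢k = ⊥-elim (k≢k refl)
            touch (suc zero) (suc (suc zero)) _ = t12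
            touch (suc zero) (suc (suc (suc zero))) _ = t13
            touch (suc (suc zero)) zero _ = flipTouch t02
            touch (suc (suc zero)) (suc zero) _ = flipTouch t12
            touch (suc (suc zero)) (suc (suc zero)) k≢k = ⊥-elim (k≢k refl)
            touch (suc (suc zero)) (suc (suc (suc zero))) _ = t23
            touch (suc (suc (suc zero))) zero _ = flipTouch t03
            touch (suc (suc (suc zero))) (suc zero) _ = flipTouch t13
            touch (suc (suc (suc zero))) (suc (suc zero)) _ = flipTouch t23
            touch (suc (suc (suc zero))) (suc (suc (suc zero))) k≢k = ⊥-elim (k≢k refl)

          -- Without crossing edges, Y ∪ {a′, v} with the edge a′v is a smaller
          -- instance: it misses s.
          module NoCrossing (noCross : ¬ Crossing C) where
            S′ : Fin n → Bool
            S′ q = inY q ∨ ((q == a′) ∨ (q == v))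

            S′-cases : ∀ {q} → S′ q ≡ true → inY q ≡ true ⊎ q ≡ a′ ⊎ q ≡ v
            S′-cases q∈ with ∨-true q∈
            ... | inj₁ q∈Y = inj₁ q∈Y
            ... | inj₂ rest with ∨-true rest
            ...   | inj₁ e = inj₂ (inj₁ (==⇒≡ e))
            ...   | inj₂ e = inj₂ (inj₂ (==⇒≡ e))

            a′∈S′ : S′ a′ ≡ true
            a′∈S′ = ∨-introʳ {inY a′} (∨-introˡ (==-refl a′))
            v∈S′ : S′ v ≡ true
            v∈S′ = ∨-introʳ {inY v} (∨-introʳ {v == a′} (==-refl v))
            Y⊆S′ : ∀ {q} → inY q ≡ true → S′ q ≡ true
            Y⊆S′ q∈Y = ∨-introˡ q∈Y

            innerY : ∀ {q} → Inner S′ a′ v q → inY q ≡ true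
            innerY (q∈ , q≢a′ , q≢v) with S′-cases q∈
            ... | inj₁ q∈Y = q∈Y
            ... | inj₂ (inj₁ e) = ⊥-elim (q≢a′ e)
            ... | inj₂ (inj₂ e) = ⊥-elim (q≢v e)

            closed′ : ∀ q → Inner S′ a′ v q → ∀ r → R q r → S′ r ≡ true
            closed′ q q-inner r e with closedC q r (innerY q-inner) e
            ... | inj₁ r∈Y = Y⊆S′ r∈Y
            ... | inj₂ (inj₁ r∈P) = ⊥-elim (noCross (q , innerY q-inner , r , r∈P , e))
            ... | inj₂ (inj₂ (inj₁ refl)) = a′∈S′
            ... | inj₂ (inj₂ (inj₂ refl)) = v∈S′

            instance′ : Instance S′ a′ v
            instance′ = record
              { s∈S = a′∈S′ ; t∈S = v∈S′ ; s≢t = a′≢v ; est = R-sym evj ; closed = closed′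
              ; three = λ q q-inner → three q (inv q (innerY q-inner))
              ; someInner = w , Y⊆S′ w∈Y , (λ e → avoids w w∈Y (inj₂ (inj₁ e))) , (λ e → avoids w w∈Y (inj₂ (inj₂ e))) }

            smaller : size S′ < size S
            smaller = size-strict S′ S S′⊆S s s∈S s∉S′
              where
              S′⊆S : S′ ⊆ᵇ S
              S′⊆S q q∈ with S′-cases q∈
              ... | inj₁ q∈Y = proj₁ (inv q q∈Y)
              ... | inj₂ (inj₁ refl) = path⊆S j (<⇒≤ j<len)
              ... | inj₂ (inj₂ refl) = path⊆S len ≤-refl
              s∉S′ : S′ s ≡ false
              s∉S′ with inY s in s∈Y
              ... | true = ⊥-elim (avoids s s∈Y s-excluded)
              ... | false rewrite ≢⇒==-false s≢a′ | ≢⇒==-false s≢v = refl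

        result : K4Model R
        result with closedComponent
        ... | C , closedC with crossing? C
        ...   | yes (y₁ , y₁∈Y , z₁ , z₁∈P , e₁) = WithComponent.crossModel C closedC y₁ z₁ y₁∈Y z₁∈P e₁
        ...   | no noCross = IH _ a′ v (WithComponent.NoCrossing.smaller C closedC noCross)
                                      (WithComponent.NoCrossing.instance′ C closedC noCross)

      result : K4Model R
      result with chords
      ... | i , zero , () , _
      ... | i , suc j₀ , i<j , (_ , evi) , (j+1<len , evj) = Split.result i j₀ i<j j+1<len evi evj

    result : K4Model R
    result = let (P , maximal) = maximalPath n initialPath (≤-trans (n≤1+n n) (n≤1+n (suc n)))
             in AtEnd.result P maximal

  inner? : ∀ S s t x → Dec (Inner S s t x)
  inner? S s t x = (S x ≟B true) ×-dec (¬? (x ≟ s) ×-dec ¬? (x ≟ t))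

  -- When no inner vertex is adjacent to s or t, the inner vertices are closed
  -- under adjacency and form a smaller instance, with an edge x₀a at any inner
  -- vertex x₀.
  dropEnds : ∀ {S s t} → Instance S s t → (∀ x → Inner S s t x → ¬ (R x s ⊎ R x t)) →
             Σ (Fin n → Bool) λ S′ → Σ (Fin n) λ s′ → Σ (Fin n) λ t′ → size S′ < size S × Instance S′ s′ t′
  dropEnds {S} {s} {t} I noEdgeToST with Instance.someInner I
  ... | x₀ , x₀-inner with Instance.three I x₀ x₀-inner
  ...   | a , b , _ , a≢b , _ , _ , ex₀a , ex₀b , _ = S′ , x₀ , a , smaller , instance′
    where
    open Instance I
    S′ : Fin n → Bool
    S′ y = S y ∧ (not (y == s) ∧ not (y == t))
    S′-intro : ∀ {y} → Inner S s t y → S′ y ≡ true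
    S′-intro {y} (y∈S , y≢s , y≢t) rewrite y∈S | ≢⇒==-false y≢s | ≢⇒==-false y≢t = refl
    S′-elim : ∀ {y} → S′ y ≡ true → Inner S s t y
    S′-elim {y} y∈ with S y | y ≟ s | y ≟ t
    S′-elim {y} y∈ | true | no y≢s | no y≢t = refl , y≢s , y≢t
    S′-elim {y} () | true | yes _ | _
    S′-elim {y} () | true | no _ | yes _
    S′-elim {y} () | false | _ | _
    inner-nbr : ∀ {y z} → Inner S s t y → R y z → S′ z ≡ true
    inner-nbr {y} y-inner e = S′-intro ( closed y y-inner _ e
                                       , (λ eq → noEdgeToST y y-inner (inj₁ (subst (R y) eq e)))
                                       , (λ eq → noEdgeToST y y-inner (inj₂ (subst (R y) eq e))))
    instance′ : Instance S′ x₀ a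
    instance′ = record
      { s∈S = S′-intro x₀-inner ; t∈S = inner-nbr x₀-inner ex₀a ; s≢t = R-irrefl ex₀a ; est = ex₀a
      ; closed = λ y (y∈ , _ , _) r e → inner-nbr (S′-elim y∈) e
      ; three = λ y (y∈ , _ , _) → three y (S′-elim y∈)
      ; someInner = b , inner-nbr x₀-inner ex₀b , (λ eq → R-irrefl ex₀b (sym eq)) , (λ eq → a≢b (sym eq)) }
    smaller : size S′ < size S
    smaller = size-strict S′ S (λ y y∈ → proj₁ (S′-elim y∈)) s s∈S s∉S′
      where
      s∉S′ : S′ s ≡ false
      s∉S′ rewrite ==-refl s with S s
      ... | true = refl
      ... | false = refl

  -- Induction on the size of S.  An inner vertex adjacent to t (or, by
  -- symmetry, to s) starts the path argument; otherwise drop s and t.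
  dirac : ∀ m S s t → size S < m → Instance S s t → K4Model R
  dirac (suc m) S s t bound I = byCases (any? (λ x → inner? S s t x ×-dec (R? x s ⊎-dec R? x t)))
    where
    IH : ∀ S′ s′ t′ → size S′ < size S → Instance S′ s′ t′ → K4Model R
    IH S′ s′ t′ lt = dirac m S′ s′ t′ (<-≤-trans lt (≤-pred bound))
    byCases : Dec (Σ (Fin n) λ x → Inner S s t x × (R x s ⊎ R x t)) → K4Model R
    byCases (yes (x , x-inner , inj₂ ext)) = PathArgument.result S s t I IH x x-inner (R-sym ext)
    byCases (yes (x , (x∈S , x≢s , x≢t) , inj₁ exs)) =
      PathArgument.result S t s (swapInstance I) IH x (x∈S , x≢t , x≢s) (R-sym exs)
    byCases (no noEdgeToST) =
      let (S′ , s′ , t′ , smaller , I′) = dropEnds I (λ x x-inner e → noEdgeToST (x , x-inner , e))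
      in IH S′ s′ t′ smaller I′

  dirac-active : (A : Fin n → Bool) → (∀ x y → R x y → A x ≡ true) →
                 (∀ v → A v ≡ true → ThreeNeighbours v) → ∀ x → A x ≡ true → K4Model R
  dirac-active A active all x x∈A with all x x∈A
  ... | a₁ , a₂ , a₃ , n₁₂ , n₁₃ , n₂₃ , e₁ , e₂ , e₃ = dirac (suc (size A)) A x a₁ (n<1+n _) instance′
    where
    instance′ : Instance A x a₁
    instance′ = record
      { s∈S = x∈A ; t∈S = active a₁ x (R-sym e₁) ; s≢t = R-irrefl e₁ ; est = e₁
      ; closed = λ y _ r e → active r y (R-sym e)
      ; three = λ y (y∈A , _ , _) → all y y∈A
      ; someInner = a₂ , active a₂ x (R-sym e₂) , (λ eq → R-irrefl e₂ (sym eq)) , (λ eq → n₁₂ (sym eq)) }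

-- Clique-colourings of edge relations (for R = Edge G these are the notions of Defs).

CliqueIn : ∀ {n} → EdgeRel n → Subset n → Set
CliqueIn R S = ∀ {u v} → u ∈ S → v ∈ S → u ≢ v → R u v

MaximalCliqueIn : ∀ {n} → EdgeRel n → Subset n → Set
MaximalCliqueIn R S = CliqueIn R S × (∀ T → CliqueIn R T → S ⊆ T → T ⊆ S)

CliqueColouring : ∀ {n} → EdgeRel n → (Fin n → Fin 2) → Set
CliqueColouring R φ = ∀ S → MaximalCliqueIn R S → 2 ≤ ∣ S ∣ → ¬ Monochromatic φ S

someMember : ∀ {n} (S : Subset n) → 1 ≤ ∣ S ∣ → Σ (Fin n) (_∈ S)
someMember (inside ∷ S) _ = zero , here
someMember (outside ∷ S) h = let (u , u∈S) = someMember S h in suc u , there u∈S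

twoMembers : ∀ {n} (S : Subset n) → 2 ≤ ∣ S ∣ → Σ (Fin n) λ u → Σ (Fin n) λ w → u ∈ S × w ∈ S × u ≢ w
twoMembers (inside ∷ S) (s≤s h) = let (u , u∈S) = someMember S h in zero , suc u , here , there u∈S , λ ()
twoMembers (outside ∷ S) h =
  let (u , w , u∈S , w∈S , u≢w) = twoMembers S h in suc u , suc w , there u∈S , there w∈S , λ e → u≢w (suc-injective e)

otherColour : Fin 2 → Fin 2
otherColour zero = suc zero
otherColour (suc _) = zero

otherColour≢ : ∀ c → otherColour c ≢ c
otherColour≢ zero ()
otherColour≢ (suc zero) ()

-- A maximal clique through v lies in
-- {v, a, b} and contains a; a maximal clique avoiding v is one of R − v.
module ExtendColouring {n} (R : EdgeRel n) (R-sym : Symmetric R) (v a b : Fin n)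
                       (a≢v : a ≢ v) (eva : R v a) (eab : R a b) (nbrs : ∀ y → R v y → OneOf a b y)
                       (φ′ : Fin n → Fin 2) (colouring′ : CliqueColouring (Without R v) φ′) where

  φ : Fin n → Fin 2
  φ x with x ≟ v
  ... | yes _ = otherColour (φ′ a)
  ... | no _ = φ′ x

  φ-v : φ v ≡ otherColour (φ′ a)
  φ-v with v ≟ v
  ... | yes _ = refl
  ... | no v≢v = ⊥-elim (v≢v refl)

  φ-≢v : ∀ {x} → x ≢ v → φ x ≡ φ′ x
  φ-≢v {x} x≢v with x ≟ v
  ... | yes x≡v = ⊥-elim (x≢v x≡v)
  ... | no _ = refl

  a∈clique : ∀ S → MaximalCliqueIn R S → v ∈ S → a ∈ S
  a∈clique S (clique , maximal) v∈S = maximal (S ∪ ⁅ a ⁆) clique⁺ (p⊆p∪q ⁅ a ⁆) (q⊆p∪q S ⁅ a ⁆ (x∈⁅x⁆ a))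
    where
    a-adjacent : ∀ {w} → w ∈ S → w ≢ a → R a w
    a-adjacent {w} w∈S w≢a with w ≟ v
    ... | yes refl = R-sym eva
    ... | no w≢v with nbrs w (R-sym (clique w∈S v∈S w≢v))
    ...   | inj₁ w≡a = ⊥-elim (w≢a w≡a)
    ...   | inj₂ refl = eab
    clique⁺ : CliqueIn R (S ∪ ⁅ a ⁆)
    clique⁺ {u} {w} u∈ w∈ u≢w with x∈p∪q⁻ S ⁅ a ⁆ u∈ | x∈p∪q⁻ S ⁅ a ⁆ w∈
    ... | inj₁ u∈S | inj₁ w∈S = clique u∈S w∈S u≢w
    ... | inj₁ u∈S | inj₂ w∈a with x∈⁅y⁆⇒x≡y a w∈a
    ...   | refl = R-sym (a-adjacent u∈S u≢w)
    clique⁺ {u} {w} u∈ w∈ u≢w | inj₂ u∈a | inj₁ w∈S with x∈⁅y⁆⇒x≡y a u∈a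
    ...   | refl = a-adjacent w∈S (λ e → u≢w (sym e))
    clique⁺ {u} {w} u∈ w∈ u≢w | inj₂ u∈a | inj₂ w∈a =
      ⊥-elim (u≢w (trans (x∈⁅y⁆⇒x≡y a u∈a) (sym (x∈⁅y⁆⇒x≡y a w∈a))))

  colouring : CliqueColouring R φ
  colouring S (clique , maximal) two mono with v ∈? S
  ... | yes v∈S = otherColour≢ (φ′ a)
      (trans (sym φ-v) (trans (mono v∈S (a∈clique S (clique , maximal) v∈S)) (φ-≢v a≢v)))
  ... | no v∉S = colouring′ S (clique′ , maximal′) two mono′
    where
    member≢v : ∀ {u} → u ∈ S → u ≢ v
    member≢v u∈S e = v∉S (subst (_∈ S) e u∈S)
    clique′ : CliqueIn (Without R v) S
    clique′ u∈S w∈S u≢w = clique u∈S w∈S u≢w , member≢v u∈S , member≢v w∈S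
    maximal′ : ∀ T → CliqueIn (Without R v) T → S ⊆ T → T ⊆ S
    maximal′ T cliqueT S⊆T = maximal T (λ u∈ w∈ u≢w → proj₁ (cliqueT u∈ w∈ u≢w)) S⊆T
    mono′ : Monochromatic φ′ S
    mono′ u∈S w∈S = trans (sym (φ-≢v (member≢v u∈S))) (trans (mono u∈S w∈S) (φ-≢v (member≢v w∈S)))

EdgesIn : ∀ {n} → EdgeRel n → (Fin n → Bool) → Set
EdgesIn R A = ∀ x y → R x y → A x ≡ true

MaximalOn : ∀ {n} → EdgeRel n → (Fin n → Bool) → Set
MaximalOn R A = ∀ u w → A u ≡ true → A w ≡ true → u ≢ w → ¬ R u w → K4Model (Join R u w)

ThreeActive : ∀ {n} → (Fin n → Bool) → Set
ThreeActive {n} A = Σ (Fin n) λ x → Σ (Fin n) λ y → Σ (Fin n) λ z →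
                    A x ≡ true × A y ≡ true × A z ≡ true × x ≢ y × x ≢ z × y ≢ z

threeActive? : ∀ {n} (A : Fin n → Bool) → Dec (ThreeActive A)
threeActive? A = any? λ x → any? λ y → any? λ z → (A x ≟B true) ×-dec ((A y ≟B true) ×-dec ((A z ≟B true) ×-dec
                 (¬? (x ≟ y) ×-dec (¬? (x ≟ z) ×-dec ¬? (y ≟ z)))))

-- With at most two active vertices, colouring one endpoint of an edge differently
-- from everything else is a clique-colouring.
fewActive-colouring : ∀ {n} (R : EdgeRel n) → Symmetric R → Irreflexive R → (∀ x y → Dec (R x y)) →
                      ∀ A → EdgesIn R A → ¬ ThreeActive A → Σ (Fin n → Fin 2) (CliqueColouring R)
fewActive-colouring R R-sym R-irrefl R? A edgesIn fewActive with any? (λ a → any? (λ b → R? a b))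
... | no noEdge = (λ _ → zero) , λ S (clique , _) two _ →
  let (u , w , u∈S , w∈S , u≢w) = twoMembers S two in noEdge (u , w , clique u∈S w∈S u≢w)
... | yes (a , b , eab) = φ , colouring
  where
  φ : Fin _ → Fin 2
  φ x with x ≟ a
  ... | yes _ = zero
  ... | no _ = suc zero
  φ-a : φ a ≡ zero
  φ-a with a ≟ a
  ... | yes _ = refl
  ... | no a≢a = ⊥-elim (a≢a refl)
  φ-b : φ b ≡ suc zero
  φ-b with b ≟ a
  ... | yes b≡a = ⊥-elim (R-irrefl eab (sym b≡a))
  ... | no _ = refl
  active∈ab : ∀ y → A y ≡ true → OneOf a b y
  active∈ab y y∈A with y ≟ a | y ≟ b
  ... | yes y≡a | _ = inj₁ y≡a
  ... | no _ | yes y≡b = inj₂ y≡b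
  ... | no y≢a | no y≢b = ⊥-elim (fewActive (a , b , y , edgesIn a b eab , edgesIn b a (R-sym eab) , y∈A
                                              , R-irrefl eab , (λ e → y≢a (sym e)) , (λ e → y≢b (sym e))))
  zero≢one : zero ≢ suc zero
  zero≢one ()
  colouring : CliqueColouring R φ
  colouring S (clique , _) two mono with twoMembers S two
  ... | u , w , u∈S , w∈S , u≢w with clique u∈S w∈S u≢w
  ...   | euw with active∈ab u (edgesIn u w euw) | active∈ab w (edgesIn w u (R-sym euw)) | mono u∈S w∈S
  ...     | inj₁ refl | inj₁ refl | _ = u≢w refl
  ...     | inj₂ refl | inj₂ refl | _ = u≢w refl
  ...     | inj₁ refl | inj₂ refl | same = zero≢one (trans (sym φ-a) (trans same φ-b))
  ...     | inj₂ refl | inj₁ refl | same = zero≢one (trans (sym φ-a) (trans (sym same) φ-b))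

module ColouringStep {n} (R : EdgeRel n) (R-sym : Symmetric R) (R-irrefl : Irreflexive R)
                     (R? : ∀ x y → Dec (R x y)) (A : Fin n → Bool) (edgesIn : EdgesIn R A)
                     (free : ¬ K4Model R) (maximal : MaximalOn R A) where
  open Dirac R R-sym R-irrefl R? using (ThreeNeighbours; dirac-active)

  threeNeighbours? : ∀ v → Dec (ThreeNeighbours v)
  threeNeighbours? v = any? λ a → any? λ b → any? λ c → ¬? (a ≟ b) ×-dec (¬? (a ≟ c) ×-dec (¬? (b ≟ c) ×-dec
                       (R? v a ×-dec (R? v b ×-dec R? v c))))

  activeAvoiding : ThreeActive A → ∀ p q → Σ (Fin n) λ r → A r ≡ true × r ≢ p × r ≢ q
  activeAvoiding (x , y , z , x∈A , y∈A , z∈A , x≢y , x≢z , y≢z) p q with avoids? x | avoids? y | avoids? z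
    where
    avoids? : ∀ c → (c ≢ p × c ≢ q) ⊎ OneOf p q c
    avoids? c with c ≟ p | c ≟ q
    ... | yes c≡p | _ = inj₂ (inj₁ c≡p)
    ... | no _ | yes c≡q = inj₂ (inj₂ c≡q)
    ... | no c≢p | no c≢q = inj₁ (c≢p , c≢q)
  ... | inj₁ (x≢p , x≢q) | _ | _ = x , x∈A , x≢p , x≢q
  ... | inj₂ _ | inj₁ (y≢p , y≢q) | _ = y , y∈A , y≢p , y≢q
  ... | inj₂ _ | inj₂ _ | inj₁ (z≢p , z≢q) = z , z∈A , z≢p , z≢q
  ... | inj₂ x∈ | inj₂ y∈ | inj₂ z∈ = ⊥-elim (notThree x∈ y∈ z∈)
    where
    notThree : OneOf p q x → OneOf p q y → OneOf p q z → ⊥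
    notThree (inj₁ refl) (inj₁ e) _ = x≢y (sym e)
    notThree (inj₂ refl) (inj₂ e) _ = x≢y (sym e)
    notThree (inj₁ refl) (inj₂ _) (inj₁ e) = x≢z (sym e)
    notThree (inj₁ _) (inj₂ refl) (inj₂ e) = y≢z (sym e)
    notThree (inj₂ _) (inj₁ refl) (inj₁ e) = y≢z (sym e)
    notThree (inj₂ refl) (inj₁ _) (inj₂ e) = x≢z (sym e)

  -- An active vertex has a neighbour: otherwise join it to another active x′
  -- and suppress it; what remains is a submodel of R.
  noIsolated : ThreeActive A → ∀ v → A v ≡ true → ¬ (∀ y → ¬ R v y)
  noIsolated three v v∈A isolated with activeAvoiding three v v
  ... | x′ , x′∈A , x′≢v , _ = free (K4Model-mono collapse M₂)
    where
    M₁ = maximal v x′ v∈A x′∈A (λ e → x′≢v (sym e)) (isolated x′)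
    nbrs : ∀ y → Join R v x′ v y → OneOf x′ x′ y
    nbrs y (inj₁ e) = ⊥-elim (isolated y e)
    nbrs y (inj₂ (_ , inj₁ (_ , y≡x′))) = inj₁ y≡x′
    nbrs y (inj₂ (_ , inj₂ (v≡x′ , _))) = ⊥-elim (x′≢v (sym v≡x′))
    M₂ = suppress-model (Join R v x′) (Join-sym R-sym) v x′ x′ x′≢v x′≢v nbrs M₁
    collapse : ∀ x y → Suppress (Join R v x′) v x′ x′ x y → R x y
    collapse x y (inj₁ (e , x≢v , y≢v)) = Join-avoiding {R = R} e x≢v y≢v
    collapse x y (inj₂ l) = ⊥-elim (Link-loop l)

  -- A leaf v whose neighbour a has another neighbour x′: join v x′ and
  -- suppress v; the new edge a x′ already exists.
  noLeaf-branching : ∀ v → A v ≡ true → ∀ a → R v a → (∀ y → R v y → y ≡ a) →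
                     ∀ x′ → R a x′ → x′ ≢ v → ⊥
  noLeaf-branching v v∈A a eva only x′ eax′ x′≢v = free (K4Model-mono collapse M₂)
    where
    x′≢a : x′ ≢ a
    x′≢a e = R-irrefl eax′ (sym e)
    a≢v : a ≢ v
    a≢v e = R-irrefl eva (sym e)
    M₁ = maximal v x′ v∈A (edgesIn x′ a (R-sym eax′)) (λ e → x′≢v (sym e)) (λ e → x′≢a (only x′ e))
    nbrs : ∀ y → Join R v x′ v y → OneOf a x′ y
    nbrs y (inj₁ e) = inj₁ (only y e)
    nbrs y (inj₂ (_ , inj₁ (_ , y≡x′))) = inj₂ y≡x′
    nbrs y (inj₂ (_ , inj₂ (v≡x′ , _))) = ⊥-elim (x′≢v (sym v≡x′))
    M₂ = suppress-model (Join R v x′) (Join-sym R-sym) v a x′ a≢v x′≢v nbrs M₁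
    collapse : ∀ x y → Suppress (Join R v x′) v a x′ x y → R x y
    collapse x y (inj₁ (e , x≢v , y≢v)) = Join-avoiding {R = R} e x≢v y≢v
    collapse x y (inj₂ l) = Link⇒edge R-sym eax′ l

  -- An isolated edge va: join v to an active x′ ∉ {v, a}, suppress a (whose
  -- only neighbour is v) and then v (whose only neighbour is now x′).
  noIsolatedEdge : ThreeActive A → ∀ v → A v ≡ true → ∀ a → R v a →
                   (∀ y → R v y → y ≡ a) → (∀ y → R a y → y ≡ v) → ⊥
  noIsolatedEdge three v v∈A a eva only onlyV with activeAvoiding three v a
  ... | x′ , x′∈A , x′≢v , x′≢a = free (K4Model-mono collapse M₃)
    where
    a≢v : a ≢ v
    a≢v e = R-irrefl eva (sym e)
    R₁ = Join R v x′
    M₁ = maximal v x′ v∈A x′∈A (λ e → x′≢v (sym e)) (λ e → x′≢a (only x′ e))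
    nbrsA : ∀ y → R₁ a y → OneOf v v y
    nbrsA y (inj₁ e) = inj₁ (onlyV y e)
    nbrsA y (inj₂ (_ , inj₁ (a≡v , _))) = ⊥-elim (a≢v a≡v)
    nbrsA y (inj₂ (_ , inj₂ (a≡x′ , _))) = ⊥-elim (x′≢a (sym a≡x′))
    R₂ = Suppress R₁ a v v
    M₂ = suppress-model R₁ (Join-sym R-sym) a v v (λ e → a≢v (sym e)) (λ e → a≢v (sym e)) nbrsA M₁
    nbrsV : ∀ y → R₂ v y → OneOf x′ x′ y
    nbrsV y (inj₁ (inj₁ e , _ , y≢a)) = ⊥-elim (y≢a (only y e))
    nbrsV y (inj₁ (inj₂ (_ , inj₁ (_ , y≡x′)) , _ , _)) = inj₁ y≡x′
    nbrsV y (inj₁ (inj₂ (_ , inj₂ (v≡x′ , _)) , _ , _)) = ⊥-elim (x′≢v (sym v≡x′))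
    nbrsV y (inj₂ l) = ⊥-elim (Link-loop l)
    M₃ = suppress-model R₂ (Join-sym (Without-sym (Join-sym R-sym))) v x′ x′ x′≢v x′≢v nbrsV M₂
    collapse : ∀ x y → Suppress R₂ v x′ x′ x y → R x y
    collapse x y (inj₂ l) = ⊥-elim (Link-loop l)
    collapse x y (inj₁ (inj₂ l , _ , _)) = ⊥-elim (Link-loop l)
    collapse x y (inj₁ (inj₁ (e , _ , _) , x≢v , y≢v)) = Join-avoiding {R = R} e x≢v y≢v

  noLeaf : ThreeActive A → ∀ v → A v ≡ true → ∀ a → R v a → ¬ (∀ y → R v y → y ≡ a)
  noLeaf three v v∈A a eva only with any? (λ x′ → R? a x′ ×-dec ¬? (x′ ≟ v))
  ... | yes (x′ , eax′ , x′≢v) = noLeaf-branching v v∈A a eva only x′ eax′ x′≢v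
  ... | no noOther = noIsolatedEdge three v v∈A a eva only
                       (λ y e → decidable-stable (y ≟ v) (λ y≢v → noOther (y , e , y≢v)))

  -- The two neighbours of a degree-2 vertex are adjacent: otherwise join them,
  -- suppress v, and undo the suppression inside R.
  neighboursAdjacent : ∀ v a b → R v a → R v b → a ≢ b → (∀ y → R v y → OneOf a b y) → R a b
  neighboursAdjacent v a b eva evb a≢b nbrs with R? a b
  ... | yes eab = eab
  ... | no ¬eab = ⊥-elim (free (unsuppress-model R R-sym v a b a≢v b≢v eva evb (K4Model-mono forget M₂)))
    where
    a≢v : a ≢ v
    a≢v e = R-irrefl eva (sym e)
    b≢v : b ≢ v
    b≢v e = R-irrefl evb (sym e)
    M₁ = maximal a b (edgesIn a v (R-sym eva)) (edgesIn b v (R-sym evb)) a≢b ¬eab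
    nbrs₁ : ∀ y → Join R a b v y → OneOf a b y
    nbrs₁ y (inj₁ e) = nbrs y e
    nbrs₁ y (inj₂ (_ , inj₁ (v≡a , _))) = ⊥-elim (a≢v (sym v≡a))
    nbrs₁ y (inj₂ (_ , inj₂ (v≡b , _))) = ⊥-elim (b≢v (sym v≡b))
    M₂ = suppress-model (Join R a b) (Join-sym R-sym) v a b a≢v b≢v nbrs₁ M₁
    forget : ∀ x y → Suppress (Join R a b) v a b x y → Suppress R v a b x y
    forget x y (inj₁ (inj₁ e , x≢v , y≢v)) = inj₁ (e , x≢v , y≢v)
    forget x y (inj₁ (inj₂ l , _ , _)) = inj₂ l
    forget x y (inj₂ l) = inj₂ l

  record DegreeTwo : Set where
    field
      v a b : Fin n
      v∈A : A v ≡ true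
      eva : R v a
      evb : R v b
      eab : R a b
      nbrs : ∀ y → R v y → OneOf a b y

  -- Dirac provides an active vertex with fewer than three neighbours, and the
  -- lemmas above pin its degree down to two.
  degreeTwo : ThreeActive A → DegreeTwo
  degreeTwo three@(x , _ , _ , x∈A , _) with any? (λ v → (A v ≟B true) ×-dec ¬? (threeNeighbours? v))
  ... | no none = ⊥-elim (free (dirac-active A edgesIn allThree x x∈A))
    where
    allThree : ∀ v → A v ≡ true → ThreeNeighbours v
    allThree v v∈A = decidable-stable (threeNeighbours? v) (λ ¬three → none (v , v∈A , ¬three))
  ... | yes (v , v∈A , ¬three) with any? (λ a → R? v a)
  ...   | no noNbr = ⊥-elim (noIsolated three v v∈A (λ y e → noNbr (y , e)))
  ...   | yes (a , eva) with any? (λ b → R? v b ×-dec ¬? (b ≟ a))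
  ...     | no noSecond = ⊥-elim (noLeaf three v v∈A a eva (λ y e → decidable-stable (y ≟ a) (λ y≢a → noSecond (y , e , y≢a))))
  ...     | yes (b , evb , b≢a) = record { v = v ; a = a ; b = b ; v∈A = v∈A ; eva = eva ; evb = evb
                                         ; eab = neighboursAdjacent v a b eva evb (λ e → b≢a (sym e)) nbrs ; nbrs = nbrs }
    where
    nbrs : ∀ y → R v y → OneOf a b y
    nbrs y e with y ≟ a | y ≟ b
    ... | yes y≡a | _ = inj₁ y≡a
    ... | no _ | yes y≡b = inj₂ y≡b
    ... | no y≢a | no y≢b = ⊥-elim (¬three (a , b , y , (λ e → b≢a (sym e)) , (λ e → y≢a (sym e)) , (λ e → y≢b (sym e)) , eva , evb , e))

  -- Deactivating a degree-2 vertex v with adjacent neighbours keeps the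
  -- invariant: a K₄-model of R − v + uw gives one of R + uw, and suppressing v
  -- there lands in R − v + uw again because ab is an edge of R − v.
  module Deactivate (d : DegreeTwo) where
    open DegreeTwo d

    a≢v : a ≢ v
    a≢v e = R-irrefl eva (sym e)
    b≢v : b ≢ v
    b≢v e = R-irrefl evb (sym e)

    R′ : EdgeRel n
    R′ = Without R v

    A′ : Fin n → Bool
    A′ x = A x ∧ not (x == v)

    A′-elim : ∀ {x} → A′ x ≡ true → A x ≡ true × x ≢ v
    A′-elim {x} x∈ with A x | x ≟ v
    A′-elim {x} x∈ | true | no x≢v = refl , x≢v
    A′-elim {x} () | true | yes _
    A′-elim {x} () | false | _

    R′-irrefl : Irreflexive R′
    R′-irrefl (e , _ , _) = R-irrefl e

    R′? : ∀ x y → Dec (R′ x y)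
    R′? x y = R? x y ×-dec (¬? (x ≟ v) ×-dec ¬? (y ≟ v))

    edgesIn′ : EdgesIn R′ A′
    edgesIn′ x y (e , x≢v , _) rewrite edgesIn x y e | ≢⇒==-false x≢v = refl

    free′ : ¬ K4Model R′
    free′ M = free (K4Model-mono (λ x y → proj₁) M)

    maximal′ : MaximalOn R′ A′
    maximal′ u w u∈ w∈ u≢w ¬e = K4Model-mono restrict M₂
      where
      u≢v = proj₂ (A′-elim u∈)
      w≢v = proj₂ (A′-elim w∈)
      M₁ = maximal u w (proj₁ (A′-elim u∈)) (proj₁ (A′-elim w∈)) u≢w (λ e → ¬e (e , u≢v , w≢v))
      nbrs₁ : ∀ y → Join R u w v y → OneOf a b y
      nbrs₁ y (inj₁ e) = nbrs y e
      nbrs₁ y (inj₂ (_ , inj₁ (v≡u , _))) = ⊥-elim (u≢v (sym v≡u))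
      nbrs₁ y (inj₂ (_ , inj₂ (v≡w , _))) = ⊥-elim (w≢v (sym v≡w))
      M₂ = suppress-model (Join R u w) (Join-sym R-sym) v a b a≢v b≢v nbrs₁ M₁
      OneOf⇒≢v : ∀ {y} → OneOf a b y → y ≢ v
      OneOf⇒≢v (inj₁ refl) = a≢v
      OneOf⇒≢v (inj₂ refl) = b≢v
      restrict : ∀ x y → Suppress (Join R u w) v a b x y → Join R′ u w x y
      restrict x y (inj₁ (inj₁ e , x≢v , y≢v)) = inj₁ (e , x≢v , y≢v)
      restrict x y (inj₁ (inj₂ l , _ , _)) = inj₂ l
      restrict x y (inj₂ l) = inj₁ (Link⇒edge R-sym eab l , OneOf⇒≢v (proj₁ (Link-ends l)) , OneOf⇒≢v (proj₂ (Link-ends l)))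

    smaller : size A′ < size A
    smaller = size-strict A′ A (λ x x∈ → proj₁ (A′-elim x∈)) v v∈A v∉A′
      where
      v∉A′ : A′ v ≡ false
      v∉A′ rewrite ==-refl v | v∈A = refl

colour : ∀ {n} m (R : EdgeRel n) → Symmetric R → Irreflexive R → (∀ x y → Dec (R x y)) →
         ∀ A → size A < m → EdgesIn R A → ¬ K4Model R → MaximalOn R A → Σ (Fin n → Fin 2) (CliqueColouring R)
colour (suc m) R R-sym R-irrefl R? A bound edgesIn free maximal with threeActive? A
... | no few = fewActive-colouring R R-sym R-irrefl R? A edgesIn few
... | yes three = ExtendColouring.φ R R-sym v a b a≢v eva eab nbrs φ′ colouring′
                , ExtendColouring.colouring R R-sym v a b a≢v eva eab nbrs φ′ colouring′
  where
  open ColouringStep R R-sym R-irrefl R? A edgesIn free maximal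
  d = degreeTwo three
  open DegreeTwo d
  open Deactivate d
  recursive = colour m R′ (Without-sym R-sym) R′-irrefl R′? A′ (<-≤-trans smaller (≤-pred bound))
                     edgesIn′ free′ maximal′
  φ′ = proj₁ recursive
  colouring′ = proj₂ recursive

-- The theorem: take every vertex active; models and minors correspond, so the
-- hypotheses of colour are exactly edge-maximal K₄-minor-freeness.
theorem3p1 : ∀ {n : ℕ} (G : Graph n) → EdgeMaximalK4MinorFree G → CliqueColorable G 2
theorem3p1 {n} G (noMinor , maximalG) =
  colour (suc n) (Edge G) (Edge-sym G) (Edge-irrefl G) (λ x y → adj G x y ≟B true) allActive
         (s≤s (size-≤ allActive)) (λ _ _ _ → refl) noModel maximal
  where
  allActive : Fin n → Bool
  allActive _ = true
  noModel : ¬ K4Model (Edge G)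
  noModel M = noMinor (model⇒minor G M)
  maximal : MaximalOn (Edge G) allActive
  maximal u w _ _ u≢w ¬e =
    K4Model-mono (λ x y → addEdge-edge⁻ G u w) (minor⇒model (maximalG u w u≢w ¬e))
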